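{- Fix $n\ge3$ and for distinct strings $A,B\in\{H,T\}^n$ let $$q(A,B)=\frac{P(B\text{ appears before }A)}{P(A\text{ appears before }B)}.$$ (i) If $A=HH\dots H$, then $q(A,B)\ge1$ for every $B\ne A$, with equality if and only if $B=TT\dots T$ or $B=HH\dots HT$. (ii) If $A=TT\dots T$, then $q(A,B)\ge1$ for every $B\ne A$, with equality if and only if $B=HH\dots H$ or $B=TT\dots TH$. (iii) If $A$ is neither $HH\dots H$ nor $TT\dots T$, then there exists a string $B\neq A$ with $q(A,B)<1$.
   Context: All strings have length $n$ over $\{H,T\}$. A fair coin is tossed repeatedly (independent tosses), and "$X$ appears before $Y$" means the string $X$ occurs as a block of consecutive tosses strictly before the first occurrence of $Y$ (for distinct strings of equal length exactly one of the two occurs first, almost surely). -}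

module Defs where

open import Data.Bool using (Bool; true; false; _∧_; if_then_else_)
open import Data.Nat using (ℕ; zero; suc; _≤_; _<_; _<ᵇ_; _^_)
open import Data.Integer as ℤ using (ℤ; +_; -_; _-_; ∣_∣)
open import Data.List using (List; []; _∷_; filter; length; concatMap)
open import Data.Maybe using (Maybe; just; nothing; map)
open import Data.Vec using (Vec; toList)
import Data.Vec as V
open import Data.Product using (∃; Σ; _×_)
open import Relation.Nullary using (¬_)
open import Relation.Nullary.Decidable using (Dec)
open import Relation.Binary.PropositionalEquality using (_≡_)

data Coin : Set where
  H T : Coin

_==_ : Coin → Coin → Bool
H == H = true
T == T = true
H == T = false
T == H = false

isPrefix : List Coin → List Coin → Bool
isPrefix [] w = true
isPrefix (c ∷ x) [] = false
isPrefix (c ∷ x) (d ∷ w) = (c == d) ∧ isPrefix x w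

first : List Coin → List Coin → Maybe ℕ
first x w with isPrefix x w
... | true = just 0
first x [] | false = nothing
first x (c ∷ w) | false = map suc (first x w)

beats : List Coin → List Coin → List Coin → Bool
beats X Y w with first X w | first Y w
... | just i | nothing = true
... | just i | just j  = i <ᵇ j
... | nothing | _      = false

allWords : ℕ → List (List Coin)
allWords zero = [] ∷ []
allWords (suc N) = concatMap (λ w → (H ∷ w) ∷ (T ∷ w) ∷ []) (allWords N)

-- number of records of length N in which X appears before Y;
-- so P_N(X appears before Y within N tosses) = count X Y N / 2^N,
-- and P(X appears before Y) = lim_N count X Y N / 2^N.
count : ∀ {n} → Vec Coin n → Vec Coin n → ℕ → ℕ
count X Y N = length (filter (λ w → beats (toList X) (toList Y) w Data.Bool.≟ true) (allWords N))
  where import Data.Bool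

diff : ∀ {n} → Vec Coin n → Vec Coin n → ℕ → ℤ
diff A B N = + count B A N - + count A B N

-- q(A,B) = P(B before A) / P(A before B); as P(A before B) > 0 for distinct
-- equal-length strings, the comparisons of q with 1 are comparisons of
-- δ = P(B before A) - P(A before B) = lim_N diff A B N / 2^N with 0.

-- q(A,B) ≥ 1  :  lim δ_N ≥ 0, i.e. ∀ ε = 1/(k+1), eventually δ_N > -ε
q≥1 : ∀ {n} → Vec Coin n → Vec Coin n → Set
q≥1 A B = ∀ (k : ℕ) → ∃ λ N → ∀ M → N ≤ M →
  - (+ (2 ^ M)) ℤ.< diff A B M ℤ.* + suc k

-- q(A,B) = 1  :  lim δ_N = 0
q≡1 : ∀ {n} → Vec Coin n → Vec Coin n → Set
q≡1 A B = ∀ (k : ℕ) → ∃ λ N → ∀ M → N ≤ M →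
  ∣ diff A B M ℤ.* + suc k ∣ < 2 ^ M

-- q(A,B) < 1  :  lim δ_N < 0, i.e. ∃ ε = 1/(k+1), eventually δ_N < -ε
q<1 : ∀ {n} → Vec Coin n → Vec Coin n → Set
q<1 A B = ∃ λ (k : ℕ) → ∃ λ N → ∀ M → N ≤ M →
  diff A B M ℤ.* + suc k ℤ.< - (+ (2 ^ M))

allH : ∀ n → Vec Coin n
allH n = V.replicate n H

allT : ∀ n → Vec Coin n
allT n = V.replicate n T

hsT : ∀ n → Vec Coin n
hsT zero = V.[]
hsT (suc zero) = T V.∷ V.[]
hsT (suc (suc n)) = H V.∷ hsT (suc n)

tsH : ∀ n → Vec Coin n
tsH zero = V.[]
tsH (suc zero) = H V.∷ V.[]
tsH (suc (suc n)) = T V.∷ tsH (suc n)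

{-# OPTIONS --safe #-}
-- Conway's martingale argument. Before every toss a new gambler enters and bets on the
-- successive letters of X, doubling his stake at each win; the total fortune of the
-- X-gamblers is a fair game, and so is the difference between the A- and the B-fortunes
-- stopped at the first appearance of A or B. Summing over all 2^N records of N tosses,
-- and writing XY for the fortune of the X-gamblers at the moment Y appears, this gives
-- (AA − BA)·#(A first) = (BB − AB)·#(B first) up to the still undecided records, whose
-- share decays geometrically. Hence q(A,B) compares with 1 as AA + AB compares with
-- BA + BB. For A = c^n these sums are compared position by position: AA + AB ≥ BA + BB,
-- with equality exactly for B = c′^n and B = c^(n−1)c′; and every non-constant A
-- does strictly worse than H^n or than T^n.
module Submission where

open import Data.Bool using (Bool; true; false; _∧_; if_then_else_)
import Data.Bool as Bool
open import Data.Empty using (⊥-elim)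
open import Function using (_∘_)
import Data.Integer as ℤ
import Data.Integer.Properties as ℤ
open import Data.List using (List; []; _∷_; _++_; _∷ʳ_; length; reverse; replicate; take; concatMap; filter)
open import Data.List.Properties
  using (length-++; length-replicate; length-reverse; reverse-++; unfold-reverse;
         reverse-involutive; ++-identityʳ; ∷-injectiveˡ; ∷-injectiveʳ; take-all)
open import Data.Maybe using (just; nothing)
import Data.Maybe as Maybe
open import Data.Nat
open import Data.Nat.Properties
open import Algebra.Properties.CommutativeSemigroup +-commutativeSemigroup using (interchange)
open import Algebra.Properties.CommutativeSemigroup *-commutativeSemigroup using (x∙yz≈y∙xz)
open import Data.Nat.Tactic.RingSolver using (solve-∀)
open import Data.Product using (∃; _×_; _,_; proj₁; proj₂)
open import Data.Sum using (_⊎_; inj₁; inj₂)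
open import Data.Vec using (Vec; toList)
import Data.Vec as Vec
import Data.Vec.Properties as Vec
open import Relation.Nullary using (¬_)
open import Relation.Binary.PropositionalEquality

open import Defs

-- Sums over all toss records

𝟙 : Bool → ℕ
𝟙 true = 1
𝟙 false = 0

sumOver : (List Coin → ℕ) → List (List Coin) → ℕ
sumOver f [] = 0
sumOver f (w ∷ ws) = f w + sumOver f ws

sumWords : ℕ → (List Coin → ℕ) → ℕ
sumWords N f = sumOver f (allWords N)

module _ {f g : List Coin → ℕ} where

  sumOver-cong : ∀ ws → (∀ w → f w ≡ g w) → sumOver f ws ≡ sumOver g ws
  sumOver-cong [] _ = refl
  sumOver-cong (w ∷ ws) f≡g = cong₂ _+_ (f≡g w) (sumOver-cong ws f≡g)

  sumOver-+ : ∀ ws → sumOver (λ w → f w + g w) ws ≡ sumOver f ws + sumOver g ws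
  sumOver-+ [] = refl
  sumOver-+ (w ∷ ws) = begin
    f w + g w + sumOver (λ w → f w + g w) ws ≡⟨ cong (f w + g w +_) (sumOver-+ ws) ⟩
    f w + g w + (sumOver f ws + sumOver g ws) ≡⟨ interchange (f w) (g w) _ _ ⟩
    f w + sumOver f ws + (g w + sumOver g ws) ∎
    where open ≡-Reasoning

sumOver-++ : ∀ f xs ys → sumOver f (xs ++ ys) ≡ sumOver f xs + sumOver f ys
sumOver-++ f [] ys = refl
sumOver-++ f (x ∷ xs) ys = trans (cong (f x +_) (sumOver-++ f xs ys)) (sym (+-assoc (f x) _ _))

sumOver-concatMap : ∀ f (h : List Coin → List (List Coin)) ws →
  sumOver f (concatMap h ws) ≡ sumOver (λ w → sumOver f (h w)) ws
sumOver-concatMap f h [] = refl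
sumOver-concatMap f h (w ∷ ws) =
  trans (sumOver-++ f (h w) (concatMap h ws)) (cong (sumOver f (h w) +_) (sumOver-concatMap f h ws))

sumOver-* : ∀ k f ws → sumOver (λ w → k * f w) ws ≡ k * sumOver f ws
sumOver-* k f [] = sym (*-zeroʳ k)
sumOver-* k f (w ∷ ws) = trans (cong (k * f w +_) (sumOver-* k f ws)) (sym (*-distribˡ-+ k (f w) _))

module _ (N : ℕ) {f g : List Coin → ℕ} where

  sumWords-cong : (∀ w → f w ≡ g w) → sumWords N f ≡ sumWords N g
  sumWords-cong = sumOver-cong (allWords N)

  sumWords-+ : sumWords N (λ w → f w + g w) ≡ sumWords N f + sumWords N g
  sumWords-+ = sumOver-+ (allWords N)

sumWords-* : ∀ N k f → sumWords N (λ w → k * f w) ≡ k * sumWords N f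
sumWords-* N k f = sumOver-* k f (allWords N)

sumWords-∷ : ∀ N f → sumWords (suc N) f ≡ sumWords N (λ w → f (H ∷ w) + f (T ∷ w))
sumWords-∷ N f = trans (sumOver-concatMap f _ (allWords N))
  (sumWords-cong N (λ w → cong (f (H ∷ w) +_) (+-identityʳ _)))

sumWords-∷ʳ : ∀ N f → sumWords (suc N) f ≡ sumWords N (λ w → f (w ∷ʳ H) + f (w ∷ʳ T))
sumWords-∷ʳ zero f = sumWords-∷ zero f
sumWords-∷ʳ (suc N) f = begin
  sumWords (suc (suc N)) f                              ≡⟨ sumWords-∷ (suc N) f ⟩
  sumWords (suc N) (λ w → f (H ∷ w) + f (T ∷ w))        ≡⟨ sumWords-∷ʳ N _ ⟩
  sumWords N (λ w → (f (H ∷ w ∷ʳ H) + f (T ∷ w ∷ʳ H)) + (f (H ∷ w ∷ʳ T) + f (T ∷ w ∷ʳ T)))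
    ≡⟨ sumWords-cong N (λ w → interchange (f (H ∷ w ∷ʳ H)) _ _ _) ⟩
  sumWords N (λ w → (f (H ∷ w ∷ʳ H) + f (H ∷ w ∷ʳ T)) + (f (T ∷ w ∷ʳ H) + f (T ∷ w ∷ʳ T)))
    ≡⟨ sym (sumWords-∷ N _) ⟩
  sumWords (suc N) (λ w → f (w ∷ʳ H) + f (w ∷ʳ T)) ∎
  where open ≡-Reasoning

sumWords-reverse : ∀ N f → sumWords N f ≡ sumWords N (f ∘ reverse)
sumWords-reverse zero f = refl
sumWords-reverse (suc N) f = begin
  sumWords (suc N) f                                          ≡⟨ sumWords-∷ʳ N f ⟩
  sumWords N (λ w → f (w ∷ʳ H) + f (w ∷ʳ T))                  ≡⟨ sumWords-reverse N _ ⟩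
  sumWords N (λ w → f (reverse w ∷ʳ H) + f (reverse w ∷ʳ T))
    ≡⟨ sumWords-cong N (λ w → sym (cong₂ _+_ (cong f (unfold-reverse H w)) (cong f (unfold-reverse T w)))) ⟩
  sumWords N (λ w → f (reverse (H ∷ w)) + f (reverse (T ∷ w))) ≡⟨ sym (sumWords-∷ N _) ⟩
  sumWords (suc N) (f ∘ reverse) ∎
  where open ≡-Reasoning

sumWords-++ : ∀ n N f → sumWords (n + N) f ≡ sumWords N (λ R → sumWords n (λ V → f (V ++ R)))
sumWords-++ zero N f = sumWords-cong N (λ R → sym (+-identityʳ (f R)))
sumWords-++ (suc n) N f = begin
  sumWords (suc n + N) f                                         ≡⟨ sumWords-∷ (n + N) f ⟩
  sumWords (n + N) (λ w → f (H ∷ w) + f (T ∷ w))                 ≡⟨ sumWords-++ n N _ ⟩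
  sumWords N (λ R → sumWords n (λ V → f (H ∷ V ++ R) + f (T ∷ V ++ R)))
    ≡⟨ sumWords-cong N (λ R → sym (sumWords-∷ n (λ V → f (V ++ R)))) ⟩
  sumWords N (λ R → sumWords (suc n) (λ V → f (V ++ R))) ∎
  where open ≡-Reasoning

sumWords-const : ∀ N k → sumWords N (λ _ → k) ≡ 2 ^ N * k
sumWords-const zero k = refl
sumWords-const (suc N) k = begin
  sumWords (suc N) (λ _ → k) ≡⟨ sumWords-∷ N _ ⟩
  sumWords N (λ _ → k + k)   ≡⟨ sumWords-const N (k + k) ⟩
  2 ^ N * (k + k)            ≡⟨ double (2 ^ N) k ⟩
  2 ^ suc N * k ∎
  where
  open ≡-Reasoning
  double : ∀ p k → p * (k + k) ≡ 2 * p * k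
  double = solve-∀

sumWords-mono : ∀ N {f g} → (∀ w → length w ≡ N → f w ≤ g w) → sumWords N f ≤ sumWords N g
sumWords-mono zero f≤g = +-monoˡ-≤ 0 (f≤g [] refl)
sumWords-mono (suc N) {f} {g} f≤g = subst₂ _≤_ (sym (sumWords-∷ N f)) (sym (sumWords-∷ N g))
  (sumWords-mono N (λ w |w|≡N → +-mono-≤ (f≤g (H ∷ w) (cong suc |w|≡N)) (f≤g (T ∷ w) (cong suc |w|≡N))))

-- Prefixes and first occurrences

==⇒≡ : ∀ c d → (c == d) ≡ true → c ≡ d
==⇒≡ H H _ = refl
==⇒≡ T T _ = refl

==-refl : ∀ c → (c == c) ≡ true
==-refl H = refl
==-refl T = refl

∧-trueˡ : ∀ {a b} → (a ∧ b) ≡ true → a ≡ true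
∧-trueˡ {true} _ = refl

∧-trueʳ : ∀ {a b} → (a ∧ b) ≡ true → b ≡ true
∧-trueʳ {true} b≡true = b≡true

isPrefix⇒++ : ∀ X u → isPrefix X u ≡ true → ∃ λ v → u ≡ X ++ v
isPrefix⇒++ [] u _ = u , refl
isPrefix⇒++ (x ∷ X) (d ∷ u) p with isPrefix⇒++ X u (∧-trueʳ {x == d} p)
... | v , u≡X++v = v , cong₂ _∷_ (sym (==⇒≡ x d (∧-trueˡ p))) u≡X++v

isPrefix-++ : ∀ X v → isPrefix X (X ++ v) ≡ true
isPrefix-++ [] v = refl
isPrefix-++ (x ∷ X) v rewrite ==-refl x = isPrefix-++ X v

isPrefix-refl : ∀ X → isPrefix X X ≡ true
isPrefix-refl X = subst (λ u → isPrefix X u ≡ true) (++-identityʳ X) (isPrefix-++ X [])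

isPrefix-length : ∀ X u → isPrefix X u ≡ true → length X ≤ length u
isPrefix-length [] u _ = z≤n
isPrefix-length (x ∷ X) (d ∷ u) p = s≤s (isPrefix-length X u (∧-trueʳ {x == d} p))

isPrefix⇒≡ : ∀ X u → isPrefix X u ≡ true → length X ≡ length u → X ≡ u
isPrefix⇒≡ [] [] _ _ = refl
isPrefix⇒≡ (x ∷ X) (d ∷ u) p |X|≡|u| =
  cong₂ _∷_ (==⇒≡ x d (∧-trueˡ p)) (isPrefix⇒≡ X u (∧-trueʳ {x == d} p) (suc-injective |X|≡|u|))

isPrefix-extend : ∀ X u v → length X ≤ length u → isPrefix X (u ++ v) ≡ isPrefix X u
isPrefix-extend [] u v _ = refl
isPrefix-extend (x ∷ X) (d ∷ u) v (s≤s |X|≤|u|) = cong ((x == d) ∧_) (isPrefix-extend X u v |X|≤|u|)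

𝟙-split : ∀ x b → 𝟙 ((x == H) ∧ b) + 𝟙 ((x == T) ∧ b) ≡ 𝟙 b
𝟙-split H true = refl
𝟙-split H false = refl
𝟙-split T true = refl
𝟙-split T false = refl

sumWords-isPrefix : ∀ Z → sumWords (length Z) (λ V → 𝟙 (isPrefix Z V)) ≡ 1
sumWords-isPrefix [] = refl
sumWords-isPrefix (z ∷ Z) =
  trans (sumWords-∷ (length Z) _) (trans (sumWords-cong (length Z) (λ V → 𝟙-split z (isPrefix Z V))) (sumWords-isPrefix Z))

first-here : ∀ X u → isPrefix X u ≡ true → first X u ≡ just 0
first-here X u p rewrite p = refl

first-[] : ∀ X → isPrefix X [] ≡ false → first X [] ≡ nothing
first-[] X p rewrite p = refl

first-∷ : ∀ X c u → isPrefix X (c ∷ u) ≡ false → first X (c ∷ u) ≡ Maybe.map suc (first X u)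
first-∷ X c u p rewrite p = refl

first≡nothing⇒¬isPrefix : ∀ X u → first X u ≡ nothing → isPrefix X u ≡ false
first≡nothing⇒¬isPrefix X u e with isPrefix X u
... | false = refl
first≡nothing⇒¬isPrefix X u () | true

first-∷-nothing : ∀ X c u → first X (c ∷ u) ≡ nothing → first X u ≡ nothing
first-∷-nothing X c u e with first X u | first-∷ X c u (first≡nothing⇒¬isPrefix X (c ∷ u) e)
... | nothing | _ = refl
... | just _ | e′ with () ← trans (sym e′) e

first-bound : ∀ X w {i} → first X w ≡ just i → i + length X ≤ length w
first-bound X w e with isPrefix X w in p
first-bound X w refl | true = isPrefix-length X w p
first-bound X (c ∷ w) e | false with first X w in q
first-bound X (c ∷ w) refl | false | just i = s≤s (first-bound X w q)

first-++ : ∀ X w v {i} → first X w ≡ just i → first X (w ++ v) ≡ just i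
first-++ X w v e with isPrefix X w in p
first-++ X w v refl | true = first-here X (w ++ v) (trans (isPrefix-extend X w v (isPrefix-length X w p)) p)
first-++ X (c ∷ w) v e | false with first X w in q
first-++ X (c ∷ w) v refl | false | just i =
  trans (first-∷ X c (w ++ v) (trans (isPrefix-extend X (c ∷ w) v |X|≤|cw|) p))
        (cong (Maybe.map suc) (first-++ X w v q))
  where
  |X|≤|cw| : length X ≤ length (c ∷ w)
  |X|≤|cw| = ≤-trans (m≤n+m (length X) i) (≤-trans (first-bound X w q) (n≤1+n _))

length-∷ʳ : ∀ (w : List Coin) c → length (w ∷ʳ c) ≡ suc (length w)
length-∷ʳ w c = trans (length-++ w) (+-comm (length w) 1)

∷ʳ≡++⇒length : ∀ w c v (X : List Coin) → w ∷ʳ c ≡ v ++ X → length v + length X ≡ suc (length w)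
∷ʳ≡++⇒length w c v X eq = trans (sym (length-++ v)) (trans (cong length (sym eq)) (length-∷ʳ w c))

∷ʳ≡++∷⇒length≤ : ∀ w c X y (u : List Coin) → w ∷ʳ c ≡ X ++ y ∷ u → length X ≤ length w
∷ʳ≡++∷⇒length≤ w c X y u eq = +-cancelʳ-≤ 1 (length X) (length w) (begin
  length X + 1          ≤⟨ +-monoʳ-≤ (length X) (s≤s z≤n) ⟩
  length X + suc (length u) ≡⟨ ∷ʳ≡++⇒length w c X (y ∷ u) eq ⟩
  suc (length w)        ≡⟨ +-comm 1 (length w) ⟩
  length w + 1 ∎)
  where open ≤-Reasoning

first-∷ʳ-suffix : ∀ X w c v → first X w ≡ nothing → w ∷ʳ c ≡ v ++ X → first X (w ∷ʳ c) ≡ just (length v)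
first-∷ʳ-suffix X w c [] _ eq = first-here X (w ∷ʳ c) (subst (λ u → isPrefix X u ≡ true) (sym eq) (isPrefix-refl X))
first-∷ʳ-suffix X [] c (f ∷ []) e eq with ∷-injectiveʳ eq
... | refl with () ← e
first-∷ʳ-suffix X [] c (f ∷ g ∷ v) e ()
first-∷ʳ-suffix X (d ∷ w) c (f ∷ v) e eq =
  trans (first-∷ X d (w ∷ʳ c) (trans (isPrefix-extend X (d ∷ w) (c ∷ []) |X|≤|dw|) (first≡nothing⇒¬isPrefix X (d ∷ w) e)))
        (cong (Maybe.map suc) (first-∷ʳ-suffix X w c v (first-∷-nothing X d w e) eq′))
  where
  eq′ : w ∷ʳ c ≡ v ++ X
  eq′ = ∷-injectiveʳ eq
  |X|≤|dw| : length X ≤ suc (length w)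
  |X|≤|dw| = ≤-trans (m≤n+m (length X) (length v)) (≤-reflexive (∷ʳ≡++⇒length w c v X eq′))

first-∷ʳ-nothing : ∀ X w c → first X w ≡ nothing → (∀ v → w ∷ʳ c ≢ v ++ X) → first X (w ∷ʳ c) ≡ nothing
first-∷ʳ-nothing X w c e notSuffix with isPrefix X (w ∷ʳ c) in p
... | true with isPrefix⇒++ X (w ∷ʳ c) p
...   | [] , eq = ⊥-elim (notSuffix [] (trans eq (++-identityʳ X)))
...   | y ∷ u , eq
  with () ← trans (sym (first≡nothing⇒¬isPrefix X w e))
                  (trans (sym (isPrefix-extend X w (c ∷ []) (∷ʳ≡++∷⇒length≤ w c X y u eq))) p)
first-∷ʳ-nothing X [] c e _ | false = cong (Maybe.map suc) e
first-∷ʳ-nothing X (d ∷ w) c e notSuffix | false = cong (Maybe.map suc)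
  (first-∷ʳ-nothing X w c (first-∷-nothing X d w e) (λ v eq → notSuffix (d ∷ v) (cong (d ∷_) eq)))

<⇒<ᵇ≡true : ∀ i j → i < j → (i <ᵇ j) ≡ true
<⇒<ᵇ≡true zero (suc j) _ = refl
<⇒<ᵇ≡true (suc i) (suc j) (s≤s i<j) = <⇒<ᵇ≡true i j i<j

>⇒<ᵇ≡false : ∀ i j → j < i → (i <ᵇ j) ≡ false
>⇒<ᵇ≡false (suc i) zero _ = refl
>⇒<ᵇ≡false (suc i) (suc j) (s≤s j<i) = >⇒<ᵇ≡false i j j<i

Leads : List Coin → List Coin → List Coin → Set
Leads X Y w = ∃ λ i → first X w ≡ just i × i + length X ≤ length w ×
  (first Y w ≡ nothing ⊎ ∃ λ j → first Y w ≡ just j × i < j)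

Leads⇒beats : ∀ X Y w → Leads X Y w → beats X Y w ≡ true
Leads⇒beats X Y w (i , fX , _ , inj₁ fY) rewrite fX | fY = refl
Leads⇒beats X Y w (i , fX , _ , inj₂ (j , fY , i<j)) rewrite fX | fY = <⇒<ᵇ≡true i j i<j

Leads⇒¬beats : ∀ X Y w → Leads Y X w → beats X Y w ≡ false
Leads⇒¬beats X Y w (j , fY , _ , inj₁ fX) rewrite fX = refl
Leads⇒¬beats X Y w (j , fY , _ , inj₂ (i , fX , j<i)) rewrite fX | fY = >⇒<ᵇ≡false i j j<i

absent⇒¬beats : ∀ X Y w → first X w ≡ nothing → beats X Y w ≡ false
absent⇒¬beats X Y w fX rewrite fX = refl

++-suffix-injective : ∀ (v v′ X Y : List Coin) → length X ≡ length Y → v ++ X ≡ v′ ++ Y → X ≡ Y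
++-suffix-injective [] [] X Y _ eq = eq
++-suffix-injective (x ∷ v) (y ∷ v′) X Y |X|≡|Y| eq = ++-suffix-injective v v′ X Y |X|≡|Y| (∷-injectiveʳ eq)
++-suffix-injective [] (y ∷ v′) X Y |X|≡|Y| eq = ⊥-elim (<-irrefl (sym |X|≡|Y|) (begin-strict
  length Y                   <⟨ s≤s (m≤n+m (length Y) (length v′)) ⟩
  suc (length v′ + length Y) ≡⟨ cong suc (length-++ v′) ⟨
  suc (length (v′ ++ Y))     ≡⟨ cong length eq ⟨
  length X ∎))
  where open ≤-Reasoning
++-suffix-injective (x ∷ v) [] X Y |X|≡|Y| eq =
  sym (++-suffix-injective [] (x ∷ v) Y X (sym |X|≡|Y|) (sym eq))

endsWith : List Coin → List Coin → Bool
endsWith X R = isPrefix (reverse X) R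

endsWith⇒++ : ∀ X R → endsWith X R ≡ true → ∃ λ v → reverse R ≡ v ++ X
endsWith⇒++ X R p with isPrefix⇒++ (reverse X) R p
... | u , R≡ = reverse u , (begin
  reverse R                       ≡⟨ cong reverse R≡ ⟩
  reverse (reverse X ++ u)        ≡⟨ reverse-++ (reverse X) u ⟩
  reverse u ++ reverse (reverse X) ≡⟨ cong (reverse u ++_) (reverse-involutive X) ⟩
  reverse u ++ X ∎)
  where open ≡-Reasoning

++⇒endsWith : ∀ X R v → reverse R ≡ v ++ X → endsWith X R ≡ true
++⇒endsWith X R v eq = subst (λ u → isPrefix (reverse X) u ≡ true) R≡ (isPrefix-++ (reverse X) (reverse v))
  where
  R≡ : reverse X ++ reverse v ≡ R
  R≡ = trans (sym (reverse-++ v X)) (trans (cong reverse (sym eq)) (reverse-involutive R))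

endsWith-reverse : ∀ X → endsWith X (reverse X) ≡ true
endsWith-reverse X = isPrefix-refl (reverse X)

Leads-∷ʳ : ∀ X Y → length X ≡ length Y → ∀ w c → Leads X Y w → Leads X Y (w ∷ʳ c)
Leads-∷ʳ X Y |X|≡|Y| w c (i , fX , i+|X|≤|w| , fY) =
  i , first-++ X w (c ∷ []) fX , ≤-trans i+|X|≤|w| (≤-trans (n≤1+n _) (≤-reflexive (sym (length-∷ʳ w c)))) , fY′ fY
  where
  wc : List Coin
  wc = w ∷ʳ c
  fY′ : (first Y w ≡ nothing ⊎ ∃ λ j → first Y w ≡ just j × i < j) →
        first Y wc ≡ nothing ⊎ ∃ λ j → first Y wc ≡ just j × i < j
  fY′ (inj₂ (j , fY , i<j)) = inj₂ (j , first-++ Y w (c ∷ []) fY , i<j)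
  fY′ (inj₁ fY) with endsWith Y (reverse wc) in p
  ... | false = inj₁ (first-∷ʳ-nothing Y w c fY notSuffix)
    where
    notSuffix : ∀ v → wc ≢ v ++ Y
    notSuffix v eq with () ← trans (sym p) (++⇒endsWith Y (reverse wc) v (trans (reverse-involutive wc) eq))
  ... | true with endsWith⇒++ Y (reverse wc) p
  ...   | v , eq′ = inj₂ (length v , first-∷ʳ-suffix Y w c v fY eq , i<|v|)
    where
    eq : wc ≡ v ++ Y
    eq = trans (sym (reverse-involutive wc)) eq′
    i<|v| : i < length v
    i<|v| = +-cancelʳ-< (length X) i (length v) (begin-strict
      i + length X       <⟨ s≤s i+|X|≤|w| ⟩
      suc (length w)     ≡⟨ ∷ʳ≡++⇒length w c v Y eq ⟨
      length v + length Y ≡⟨ cong (length v +_) |X|≡|Y| ⟨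
      length v + length X ∎)
      where open ≤-Reasoning

first-∷ʳ-absent : ∀ X R c → first X (reverse R) ≡ nothing → endsWith X (c ∷ R) ≡ false →
                   first X (reverse R ∷ʳ c) ≡ nothing
first-∷ʳ-absent X R c noX p = first-∷ʳ-nothing X (reverse R) c noX notSuffix
  where
  notSuffix : ∀ v → reverse R ∷ʳ c ≢ v ++ X
  notSuffix v eq with () ← trans (sym p) (++⇒endsWith X (c ∷ R) v (trans (unfold-reverse c R) eq))

Leads-new : ∀ X Y R c → length X ≡ length Y → X ≢ Y → first X (reverse R) ≡ nothing → first Y (reverse R) ≡ nothing →
            endsWith X (c ∷ R) ≡ true → Leads X Y (reverse R ∷ʳ c)
Leads-new X Y R c |X|≡|Y| X≢Y noX noY p with endsWith⇒++ X (c ∷ R) p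
... | v , eq′ =
  length v , first-∷ʳ-suffix X w c v noX eq ,
  ≤-reflexive (trans (∷ʳ≡++⇒length w c v X eq) (sym (length-∷ʳ w c))) ,
  inj₁ (first-∷ʳ-nothing Y w c noY (λ v′ eq″ → X≢Y (++-suffix-injective v v′ X Y |X|≡|Y| (trans (sym eq) eq″))))
  where
  w : List Coin
  w = reverse R
  eq : w ∷ʳ c ≡ v ++ X
  eq = trans (sym (unfold-reverse c R)) eq′

-- Conway's gamblers

-- Letters are indexed from 0; the junk value H past the end is never inspected.
letter : List Coin → ℕ → Coin
letter [] _ = H
letter (x ∷ X) zero = x
letter (x ∷ X) (suc i) = letter X i

revPrefix : List Coin → ℕ → List Coin
revPrefix X zero = []
revPrefix X (suc j) = letter X j ∷ revPrefix X j

-- Records are stored most recent toss first, so matches X j R says that the last j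
-- tosses spell the first j letters of X.
matches : List Coin → ℕ → List Coin → Bool
matches X j R = isPrefix (revPrefix X j) R

-- Before every toss a new gambler stakes 1 on X and keeps doubling it
-- while the tosses follow X; capital X R j is the total fortune of the last j of them
-- (plus the unit of the current newcomer).
capital : List Coin → List Coin → ℕ → ℕ
capital X R zero = 1
capital X R (suc j) = capital X R j + 𝟙 (matches X (suc j) R) * 2 ^ suc j

private
  regroup : ∀ a b u v e → (a + u * (2 * e)) + (b + v * (2 * e)) ≡ (a + b) + 2 * ((u + v) * e)
  regroup = solve-∀

capital-fair : ∀ X R j → capital X (H ∷ R) (suc j) + capital X (T ∷ R) (suc j) ≡ 2 + 2 * capital X R j
capital-fair X R zero =
  trans (regroup 1 1 (𝟙 ((letter X 0 == H) ∧ true)) (𝟙 ((letter X 0 == T) ∧ true)) 1)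
        (cong (λ b → 2 + 2 * (b * 1)) (𝟙-split (letter X 0) true))
capital-fair X R (suc j) = begin
  (capital X (H ∷ R) (suc j) + u * (2 * 2 ^ suc j)) + (capital X (T ∷ R) (suc j) + v * (2 * 2 ^ suc j))
    ≡⟨ regroup (capital X (H ∷ R) (suc j)) (capital X (T ∷ R) (suc j)) u v (2 ^ suc j) ⟩
  (capital X (H ∷ R) (suc j) + capital X (T ∷ R) (suc j)) + 2 * ((u + v) * 2 ^ suc j)
    ≡⟨ cong₂ (λ a b → a + 2 * (b * 2 ^ suc j)) (capital-fair X R j) (𝟙-split (letter X (suc j)) (matches X (suc j) R)) ⟩
  2 + 2 * capital X R j + 2 * (𝟙 (matches X (suc j) R) * 2 ^ suc j)
    ≡⟨ factor (capital X R j) (𝟙 (matches X (suc j) R)) (2 ^ suc j) ⟩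
  2 + 2 * capital X R (suc j) ∎
  where
  open ≡-Reasoning
  u v : ℕ
  u = 𝟙 ((letter X (suc j) == H) ∧ matches X (suc j) R)
  v = 𝟙 ((letter X (suc j) == T) ∧ matches X (suc j) R)
  factor : ∀ p m e → 2 + 2 * p + 2 * (m * e) ≡ 2 + 2 * (p + m * e)
  factor = solve-∀

take-suc-letter : ∀ j (X : List Coin) → j < length X → take (suc j) X ≡ take j X ∷ʳ letter X j
take-suc-letter zero (x ∷ X) _ = refl
take-suc-letter (suc j) (x ∷ X) (s≤s j<|X|) = cong (x ∷_) (take-suc-letter j X j<|X|)

revPrefix≡reverse-take : ∀ X j → j ≤ length X → revPrefix X j ≡ reverse (take j X)
revPrefix≡reverse-take X zero _ = refl
revPrefix≡reverse-take X (suc j) j<|X| = begin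
  letter X j ∷ revPrefix X j          ≡⟨ cong (letter X j ∷_) (revPrefix≡reverse-take X j (<⇒≤ j<|X|)) ⟩
  letter X j ∷ reverse (take j X)     ≡⟨ reverse-++ (take j X) (letter X j ∷ []) ⟨
  reverse (take j X ∷ʳ letter X j)    ≡⟨ cong reverse (take-suc-letter j X j<|X|) ⟨
  reverse (take (suc j) X) ∎
  where open ≡-Reasoning

revPrefix-length : ∀ X → revPrefix X (length X) ≡ reverse X
revPrefix-length X = trans (revPrefix≡reverse-take X (length X) ≤-refl) (cong reverse (take-all (length X) X ≤-refl))

length-revPrefix : ∀ X j → length (revPrefix X j) ≡ j
length-revPrefix X zero = refl
length-revPrefix X (suc j) = cong suc (length-revPrefix X j)

capital-extend : ∀ X R u j → j ≤ length R → capital X (R ++ u) j ≡ capital X R j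
capital-extend X R u zero _ = refl
capital-extend X R u (suc j) j<|R| = cong₂ (λ a b → a + 𝟙 b * 2 ^ suc j)
  (capital-extend X R u j (<⇒≤ j<|R|))
  (isPrefix-extend (revPrefix X (suc j)) R u (≤-trans (≤-reflexive (length-revPrefix X (suc j))) j<|R|))

capital-[] : ∀ X j → capital X [] j ≡ 1
capital-[] X zero = refl
capital-[] X (suc j) = trans (+-identityʳ _) (capital-[] X j)

𝟙≤1 : ∀ b → 𝟙 b ≤ 1
𝟙≤1 true = ≤-refl
𝟙≤1 false = z≤n

capital≤ : ∀ X R j → capital X R j ≤ 2 ^ suc j
capital≤ X R zero = s≤s z≤n
capital≤ X R (suc j) = begin
  capital X R j + 𝟙 (matches X (suc j) R) * 2 ^ suc j ≤⟨ +-mono-≤ (capital≤ X R j) (*-monoˡ-≤ (2 ^ suc j) (𝟙≤1 (matches X (suc j) R))) ⟩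
  2 ^ suc j + 1 * 2 ^ suc j                           ≡⟨ cong (2 ^ suc j +_) (*-identityˡ _) ⟩
  2 ^ suc j + 2 ^ suc j                               ≡⟨ cong (2 ^ suc j +_) (+-identityʳ _) ⟨
  2 ^ suc (suc j) ∎
  where open ≤-Reasoning

capital-pos : ∀ X R j → 1 ≤ capital X R j
capital-pos X R zero = ≤-refl
capital-pos X R (suc j) = ≤-trans (capital-pos X R j) (m≤m+n _ _)

2^≡suc : ∀ j → ∃ λ a → 2 ^ j ≡ suc a
2^≡suc zero = 0 , refl
2^≡suc (suc j) with 2^≡suc j
... | a , 2^j≡1+a = a + suc a , trans (cong (λ z → z + (z + 0)) 2^j≡1+a) (cong (suc a +_) (+-identityʳ _))

bernoulli : ∀ a m → a ^ m * (a + m) ≤ a * suc a ^ m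
bernoulli a zero = ≤-reflexive (trans (+-identityʳ _) (trans (+-identityʳ a) (sym (*-identityʳ a))))
bernoulli a (suc m) = begin
  a * a ^ m * (a + suc m)     ≡⟨ e₁ a (a ^ m) m ⟩
  a ^ m * (a * (a + suc m))   ≤⟨ *-monoʳ-≤ (a ^ m) (subst₂ _≤_ (sym (e₂ a m)) (sym (e₃ a m)) (m≤m+n _ m)) ⟩
  a ^ m * (suc a * (a + m))   ≡⟨ e₄ (a ^ m) a m ⟩
  suc a * (a ^ m * (a + m))   ≤⟨ *-monoʳ-≤ (suc a) (bernoulli a m) ⟩
  suc a * (a * suc a ^ m)     ≡⟨ e₅ a (suc a ^ m) ⟩
  a * (suc a * suc a ^ m) ∎
  where
  open ≤-Reasoning
  e₁ : ∀ a x m → a * x * (a + suc m) ≡ x * (a * (a + suc m))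
  e₁ = solve-∀
  e₂ : ∀ a m → a * (a + suc m) ≡ a * a + a * m + a
  e₂ = solve-∀
  e₃ : ∀ a m → suc a * (a + m) ≡ a * a + a * m + a + m
  e₃ = solve-∀
  e₄ : ∀ x a m → x * (suc a * (a + m)) ≡ suc a * (x * (a + m))
  e₄ = solve-∀
  e₅ : ∀ a y → suc a * (a * y) ≡ a * (suc a * y)
  e₅ = solve-∀

*^<suc^ : ∀ C a → C * a ^ suc (C * a) < suc a ^ suc (C * a)
*^<suc^ C a = *-cancelʳ-< (a + m) (C * a ^ m) (suc a ^ m) (begin-strict
  C * a ^ m * (a + m)       ≡⟨ *-assoc C (a ^ m) (a + m) ⟩
  C * (a ^ m * (a + m))     ≤⟨ *-monoʳ-≤ C (bernoulli a m) ⟩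
  C * (a * suc a ^ m)       ≡⟨ *-assoc C a (suc a ^ m) ⟨
  C * a * suc a ^ m         <⟨ *-monoˡ-< (suc a ^ m) {{m^n≢0 (suc a) m}} (s≤s (m≤n+m (C * a) a)) ⟩
  suc (a + C * a) * suc a ^ m ≡⟨ cong (_* suc a ^ m) (sym (+-suc a (C * a))) ⟩
  (a + m) * suc a ^ m       ≡⟨ *-comm (a + m) (suc a ^ m) ⟩
  suc a ^ m * (a + m) ∎)
  where
  open ≤-Reasoning
  m : ℕ
  m = suc (C * a)

module _ where
  open import Data.Integer using (+_; -_; _⊖_; ∣_∣; -<+; -<-)

  +-*-⊖ : ∀ y x c → (+ y ℤ.- + x) ℤ.* + c ≡ (y * c) ⊖ (x * c)
  +-*-⊖ y x c = begin
    (+ y ℤ.+ (- + x)) ℤ.* + c       ≡⟨ ℤ.*-distribʳ-+ (+ c) (+ y) (- + x) ⟩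
    + y ℤ.* + c ℤ.+ (- + x) ℤ.* + c ≡⟨ cong₂ ℤ._+_ (sym (ℤ.pos-* y c))
                                        (trans (sym (ℤ.neg-distribˡ-* (+ x) (+ c))) (cong -_ (sym (ℤ.pos-* x c)))) ⟩
    + (y * c) ℤ.+ (- + (x * c))     ≡⟨ ℤ.m-n≡m⊖n (y * c) (x * c) ⟩
    (y * c) ⊖ (x * c) ∎
    where open ≡-Reasoning

  private
    +⊖ : ∀ q d → (q + d) ⊖ q ≡ + d
    +⊖ q d = trans (ℤ.⊖-≥ (m≤m+n q d)) (cong +_ (m+n∸m≡n q d))

    ⊖+ : ∀ p d → p ⊖ (p + suc d) ≡ - + suc d
    ⊖+ p d = trans (ℤ.⊖-< (m<m+n p (s≤s z≤n))) (cong (λ z → - + z) (m+n∸m≡n p (suc d)))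

    ≥⊎< : ∀ p q → (∃ λ d → p ≡ q + d) ⊎ (∃ λ d → q ≡ p + suc d)
    ≥⊎< p zero = inj₁ (p , refl)
    ≥⊎< zero (suc q) = inj₂ (q , refl)
    ≥⊎< (suc p) (suc q) with ≥⊎< p q
    ... | inj₁ (d , e) = inj₁ (d , cong suc e)
    ... | inj₂ (d , e) = inj₂ (d , cong suc e)

  -K<⊖ : ∀ p q K .{{_ : NonZero K}} → q < p + K → - (+ K) ℤ.< p ⊖ q
  -K<⊖ p q (suc K) q<p+K with ≥⊎< p q
  ... | inj₁ (d , refl) rewrite +⊖ q d = -<+
  ... | inj₂ (d , refl) rewrite ⊖+ p d = -<- (s<s⁻¹ (+-cancelˡ-< p (suc d) (suc K) q<p+K))

  ∣⊖∣< : ∀ p q K → p < q + K → q < p + K → ∣ p ⊖ q ∣ < K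
  ∣⊖∣< p q K p<q+K q<p+K with ≥⊎< p q
  ... | inj₁ (d , refl) rewrite +⊖ q d = +-cancelˡ-< q d K p<q+K
  ... | inj₂ (d , refl) rewrite ⊖+ p d = +-cancelˡ-< p (suc d) K q<p+K

  ∣⊖∣<⇒< : ∀ p q K → ∣ p ⊖ q ∣ < K → p < q + K
  ∣⊖∣<⇒< p q K ∣p⊖q∣<K with ≥⊎< p q
  ... | inj₁ (d , refl) rewrite +⊖ q d = +-monoʳ-< q ∣p⊖q∣<K
  ... | inj₂ (d , refl) = ≤-trans (m<m+n p (s≤s z≤n)) (m≤m+n (p + suc d) K)

  ⊖<- : ∀ p q K → p + K < q → p ⊖ q ℤ.< - (+ K)
  ⊖<- p q K p+K<q with ≥⊎< p q
  ... | inj₁ (d , refl) = ⊥-elim (<⇒≱ p+K<q (≤-trans (m≤m+n q d) (m≤m+n (q + d) K)))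
  ... | inj₂ (d , refl) rewrite ⊖+ p d = flip K d (+-cancelˡ-< p K (suc d) p+K<q)
    where
    flip : ∀ K d → K < suc d → - (+ suc d) ℤ.< - (+ K)
    flip zero d _ = -<+
    flip (suc K) d (s≤s K<d) = -<- K<d

-- The race between A and B

data Race : Set where
  wonA wonB pending : Race

isWonA isWonB isPending : Race → Bool
isWonA wonA = true
isWonA _ = false
isWonB wonB = true
isWonB _ = false
isPending pending = true
isPending _ = false

module RaceBetween {k : ℕ} (A B : List Coin) (|A|≡n : length A ≡ suc k) (|B|≡n : length B ≡ suc k) (A≢B : A ≢ B) where

  n : ℕ
  n = suc k

  |A|≡|B| : length A ≡ length B
  |A|≡|B| = trans |A|≡n (sym |B|≡n)

  step : Race → List Coin → Race
  step pending R = if endsWith A R then wonA else if endsWith B R then wonB else pending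
  step decided R = decided

  stateAfter : List Coin → Race
  stateAfter [] = pending
  stateAfter (c ∷ R) = step (stateAfter R) (c ∷ R)

  Describes : Race → List Coin → Set
  Describes pending w = first A w ≡ nothing × first B w ≡ nothing
  Describes wonA w = Leads A B w
  Describes wonB w = Leads B A w

  describes-step : ∀ s R c → Describes s (reverse R) → Describes (step s (c ∷ R)) (reverse R ∷ʳ c)
  describes-step wonA R c A-leads = Leads-∷ʳ A B |A|≡|B| (reverse R) c A-leads
  describes-step wonB R c B-leads = Leads-∷ʳ B A (sym |A|≡|B|) (reverse R) c B-leads
  describes-step pending R c (noA , noB) with endsWith A (c ∷ R) in pA
  ... | true = Leads-new A B R c |A|≡|B| A≢B noA noB pA
  ... | false with endsWith B (c ∷ R) in pB
  ...   | true = Leads-new B A R c (sym |A|≡|B|) (A≢B ∘ sym) noB noA pB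
  ...   | false = first-∷ʳ-absent A R c noA pA , first-∷ʳ-absent B R c noB pB

  stateAfter-describes : ∀ R → Describes (stateAfter R) (reverse R)
  stateAfter-describes [] = first-[] A (nonempty A |A|≡n) , first-[] B (nonempty B |B|≡n)
    where
    nonempty : ∀ X → length X ≡ suc k → isPrefix X [] ≡ false
    nonempty (x ∷ X) _ = refl
  stateAfter-describes (c ∷ R) = subst (Describes (stateAfter (c ∷ R))) (sym (unfold-reverse c R))
    (describes-step (stateAfter R) R c (stateAfter-describes R))

  beatsA≡isWonA : ∀ R → beats A B (reverse R) ≡ isWonA (stateAfter R)
  beatsA≡isWonA R = from (stateAfter R) (stateAfter-describes R)
    where
    from : ∀ s → Describes s (reverse R) → beats A B (reverse R) ≡ isWonA s
    from wonA A-leads = Leads⇒beats A B _ A-leads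
    from wonB B-leads = Leads⇒¬beats A B _ B-leads
    from pending (noA , _) = absent⇒¬beats A B _ noA

  beatsB≡isWonB : ∀ R → beats B A (reverse R) ≡ isWonB (stateAfter R)
  beatsB≡isWonB R = from (stateAfter R) (stateAfter-describes R)
    where
    from : ∀ s → Describes s (reverse R) → beats B A (reverse R) ≡ isWonB s
    from wonA A-leads = Leads⇒¬beats B A _ A-leads
    from wonB B-leads = Leads⇒beats B A _ B-leads
    from pending (_ , noB) = absent⇒¬beats B A _ noB

  step≡pending : ∀ s R → step s R ≡ pending → s ≡ pending × endsWith A R ≡ false × endsWith B R ≡ false
  step≡pending pending R e with endsWith A R | endsWith B R
  ... | false | false = refl , refl , refl

  endsWith-short : ∀ X R → length X ≡ n → length R < n → endsWith X R ≡ false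
  endsWith-short X R |X|≡n |R|<n with endsWith X R in p
  ... | false = refl
  ... | true = ⊥-elim (<⇒≱ |R|<n (begin
    n                   ≡⟨ trans (sym |X|≡n) (sym (length-reverse X)) ⟩
    length (reverse X)  ≤⟨ isPrefix-length (reverse X) R p ⟩
    length R ∎))
    where open ≤-Reasoning

  pending⇒¬endsWith : ∀ R → stateAfter R ≡ pending → endsWith A R ≡ false × endsWith B R ≡ false
  pending⇒¬endsWith [] _ = endsWith-short A [] |A|≡n (s≤s z≤n) , endsWith-short B [] |B|≡n (s≤s z≤n)
  pending⇒¬endsWith (c ∷ R) e = proj₂ (step≡pending (stateAfter R) (c ∷ R) e)

  matches-full : ∀ X R → length X ≡ n → matches X n R ≡ endsWith X R
  matches-full X R |X|≡n = cong (λ Z → isPrefix Z R) (trans (cong (revPrefix X) (sym |X|≡n)) (revPrefix-length X))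

  capital-ending : ∀ X R → length X ≡ n → endsWith X R ≡ true → capital X R n ≡ capital X R k + 2 ^ n
  capital-ending X R |X|≡n p =
    trans (cong (λ b → capital X R k + 𝟙 b * 2 ^ n) (trans (matches-full X R |X|≡n) p)) (cong (capital X R k +_) (+-identityʳ _))

  capital-not-ending : ∀ X R → length X ≡ n → endsWith X R ≡ false → capital X R n ≡ capital X R k
  capital-not-ending X R |X|≡n p =
    trans (cong (λ b → capital X R k + 𝟙 b * 2 ^ n) (trans (matches-full X R |X|≡n) p)) (+-identityʳ _)

  endsWith⇒capital : ∀ X Y R → length Y ≡ n → endsWith Y R ≡ true → capital X R n ≡ capital X (reverse Y) n
  endsWith⇒capital X Y R |Y|≡n p with endsWith⇒++ Y R p
  ... | v , eq = trans (cong (λ Z → capital X Z n) R≡) (capital-extend X (reverse Y) (reverse v) n |rY|≥n)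
    where
    R≡ : R ≡ reverse Y ++ reverse v
    R≡ = trans (sym (reverse-involutive R)) (trans (cong reverse eq) (reverse-++ v Y))
    |rY|≥n : n ≤ length (reverse Y)
    |rY|≥n = ≤-reflexive (sym (trans (length-reverse Y) |Y|≡n))

  capitalAt : Race → List Coin → List Coin → ℕ
  capitalAt wonA X R = capital X (reverse A) n
  capitalAt wonB X R = capital X (reverse B) n
  capitalAt pending X R = capital X R n

  stoppedCapital : List Coin → List Coin → ℕ
  stoppedCapital X R = capitalAt (stateAfter R) X R

  capitalAt-step-pending : ∀ X R → capitalAt (step pending R) X R ≡ capital X R n
  capitalAt-step-pending X R with endsWith A R in pA
  ... | true = sym (endsWith⇒capital X A R |A|≡n pA)
  ... | false with endsWith B R in pB
  ...   | true = sym (endsWith⇒capital X B R |B|≡n pB)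
  ...   | false = refl

  private
    swap : ∀ a b → a + a + 2 * b ≡ b + b + 2 * a
    swap = solve-∀
    exchange : ∀ a b → 2 + 2 * a + 2 * b ≡ 2 + 2 * b + 2 * a
    exchange = solve-∀

  stoppedCapital-fair : ∀ R →
    stoppedCapital A (H ∷ R) + stoppedCapital A (T ∷ R) + 2 * stoppedCapital B R ≡
    stoppedCapital B (H ∷ R) + stoppedCapital B (T ∷ R) + 2 * stoppedCapital A R
  stoppedCapital-fair R with stateAfter R in e
  ... | wonA = swap (capital A (reverse A) n) (capital B (reverse A) n)
  ... | wonB = swap (capital A (reverse B) n) (capital B (reverse B) n)
  ... | pending = begin
    capitalAt (step pending (H ∷ R)) A (H ∷ R) + capitalAt (step pending (T ∷ R)) A (T ∷ R) + 2 * capital B R n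
      ≡⟨ cong₂ (λ a b → a + b + 2 * capital B R n) (capitalAt-step-pending A (H ∷ R)) (capitalAt-step-pending A (T ∷ R)) ⟩
    capital A (H ∷ R) n + capital A (T ∷ R) n + 2 * capital B R n
      ≡⟨ cong₂ (λ a b → a + 2 * b) (capital-fair A R k) (capital-not-ending B R |B|≡n ¬B) ⟩
    2 + 2 * capital A R k + 2 * capital B R k
      ≡⟨ exchange (capital A R k) (capital B R k) ⟩
    2 + 2 * capital B R k + 2 * capital A R k
      ≡⟨ cong₂ (λ a b → a + 2 * b) (capital-fair B R k) (capital-not-ending A R |A|≡n ¬A) ⟨
    capital B (H ∷ R) n + capital B (T ∷ R) n + 2 * capital A R n
      ≡⟨ cong₂ (λ a b → a + b + 2 * capital A R n) (capitalAt-step-pending B (H ∷ R)) (capitalAt-step-pending B (T ∷ R)) ⟨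
    capitalAt (step pending (H ∷ R)) B (H ∷ R) + capitalAt (step pending (T ∷ R)) B (T ∷ R) + 2 * capital A R n ∎
    where
    open ≡-Reasoning
    ¬A : endsWith A R ≡ false
    ¬A = proj₁ (pending⇒¬endsWith R e)
    ¬B : endsWith B R ≡ false
    ¬B = proj₂ (pending⇒¬endsWith R e)

  sum-stoppedCapital-equal : ∀ N → sumWords N (stoppedCapital A) ≡ sumWords N (stoppedCapital B)
  sum-stoppedCapital-equal zero = cong (_+ 0) (trans (capital-[] A n) (sym (capital-[] B n)))
  sum-stoppedCapital-equal (suc N) = +-cancelʳ-≡ (2 * sumWords N (stoppedCapital B)) _ _ (begin
    sumWords (suc N) (stoppedCapital A) + 2 * sumWords N (stoppedCapital B)
      ≡⟨ cong₂ _+_ (sumWords-∷ N (stoppedCapital A)) (sym (sumWords-* N 2 (stoppedCapital B))) ⟩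
    sumWords N (λ R → stoppedCapital A (H ∷ R) + stoppedCapital A (T ∷ R)) + sumWords N (λ R → 2 * stoppedCapital B R)
      ≡⟨ sumWords-+ N ⟨
    sumWords N (λ R → stoppedCapital A (H ∷ R) + stoppedCapital A (T ∷ R) + 2 * stoppedCapital B R)
      ≡⟨ sumWords-cong N stoppedCapital-fair ⟩
    sumWords N (λ R → stoppedCapital B (H ∷ R) + stoppedCapital B (T ∷ R) + 2 * stoppedCapital A R)
      ≡⟨ sumWords-+ N ⟩
    sumWords N (λ R → stoppedCapital B (H ∷ R) + stoppedCapital B (T ∷ R)) + sumWords N (λ R → 2 * stoppedCapital A R)
      ≡⟨ cong₂ _+_ (sym (sumWords-∷ N (stoppedCapital B)))
                   (trans (sumWords-* N 2 (stoppedCapital A)) (cong (2 *_) (sum-stoppedCapital-equal N))) ⟩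
    sumWords (suc N) (stoppedCapital B) + 2 * sumWords N (stoppedCapital B) ∎)
    where open ≡-Reasoning

  private
    select₁ : ∀ a b c → a ≡ a * 1 + b * 0 + 0 * c
    select₁ = solve-∀
    select₂ : ∀ a b c → b ≡ a * 0 + b * 1 + 0 * c
    select₂ = solve-∀
    select₃ : ∀ a b c → c ≡ a * 0 + b * 0 + 1 * c
    select₃ = solve-∀

  𝟙pending : List Coin → ℕ
  𝟙pending R = 𝟙 (isPending (stateAfter R))

  winsA winsB pendings : ℕ → ℕ
  winsA N = sumWords N (λ R → 𝟙 (isWonA (stateAfter R)))
  winsB N = sumWords N (λ R → 𝟙 (isWonB (stateAfter R)))
  pendings N = sumWords N 𝟙pending

  pendingCapital : List Coin → ℕ → ℕ
  pendingCapital X N = sumWords N (λ R → 𝟙pending R * capital X R n)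

  stoppedCapital-split : ∀ X R → stoppedCapital X R ≡
    capital X (reverse A) n * 𝟙 (isWonA (stateAfter R)) + capital X (reverse B) n * 𝟙 (isWonB (stateAfter R))
    + 𝟙pending R * capital X R n
  stoppedCapital-split X R with stateAfter R
  ... | wonA = select₁ (capital X (reverse A) n) (capital X (reverse B) n) (capital X R n)
  ... | wonB = select₂ (capital X (reverse A) n) (capital X (reverse B) n) (capital X R n)
  ... | pending = select₃ (capital X (reverse A) n) (capital X (reverse B) n) (capital X R n)

  sum-stoppedCapital : ∀ X N → sumWords N (stoppedCapital X) ≡
    capital X (reverse A) n * winsA N + capital X (reverse B) n * winsB N + pendingCapital X N
  sum-stoppedCapital X N = begin
    sumWords N (stoppedCapital X)
      ≡⟨ sumWords-cong N (stoppedCapital-split X) ⟩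
    sumWords N (λ R → a * 𝟙 (isWonA (stateAfter R)) + b * 𝟙 (isWonB (stateAfter R)) + 𝟙pending R * capital X R n)
      ≡⟨ trans (sumWords-+ N) (cong (_+ pendingCapital X N) (sumWords-+ N)) ⟩
    sumWords N (λ R → a * 𝟙 (isWonA (stateAfter R))) + sumWords N (λ R → b * 𝟙 (isWonB (stateAfter R))) + pendingCapital X N
      ≡⟨ cong₂ (λ u v → u + v + pendingCapital X N) (sumWords-* N a _) (sumWords-* N b _) ⟩
    a * winsA N + b * winsB N + pendingCapital X N ∎
    where
    open ≡-Reasoning
    a b : ℕ
    a = capital X (reverse A) n
    b = capital X (reverse B) n

  conway-identity : ∀ N →
    capital A (reverse A) n * winsA N + capital A (reverse B) n * winsB N + pendingCapital A N ≡
    capital B (reverse A) n * winsA N + capital B (reverse B) n * winsB N + pendingCapital B N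
  conway-identity N = trans (sym (sum-stoppedCapital A N)) (trans (sum-stoppedCapital-equal N) (sum-stoppedCapital B N))

  pendingCapital≤ : ∀ X N → pendingCapital X N ≤ 2 ^ suc n * pendings N
  pendingCapital≤ X N = begin
    pendingCapital X N
      ≤⟨ sumWords-mono N (λ R _ → *-monoʳ-≤ (𝟙pending R) (capital≤ X R n)) ⟩
    sumWords N (λ R → 𝟙pending R * 2 ^ suc n)
      ≡⟨ sumWords-cong N (λ R → *-comm (𝟙pending R) (2 ^ suc n)) ⟩
    sumWords N (λ R → 2 ^ suc n * 𝟙pending R)
      ≡⟨ sumWords-* N (2 ^ suc n) 𝟙pending ⟩
    2 ^ suc n * pendings N ∎
    where open ≤-Reasoning

  endsWith-other : ∀ X Y → length X ≡ length Y → X ≢ Y → endsWith X (reverse Y) ≡ false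
  endsWith-other X Y |X|≡|Y| X≢Y with endsWith X (reverse Y) in p
  ... | false = refl
  ... | true with endsWith⇒++ X (reverse Y) p
  ...   | v , eq = ⊥-elim (X≢Y (++-suffix-injective v [] X Y |X|≡|Y| (trans (sym eq) (reverse-involutive Y))))

  capital-self>other : ∀ X Y → length X ≡ n → length Y ≡ n → X ≢ Y → capital Y (reverse X) n < capital X (reverse X) n
  capital-self>other X Y |X|≡n |Y|≡n X≢Y = begin-strict
    capital Y (reverse X) n     ≡⟨ capital-not-ending Y (reverse X) |Y|≡n (endsWith-other Y X (trans |Y|≡n (sym |X|≡n)) (X≢Y ∘ sym)) ⟩
    capital Y (reverse X) k     ≤⟨ capital≤ Y (reverse X) k ⟩
    2 ^ n                       <⟨ m<m+n (2 ^ n) (capital-pos X (reverse X) k) ⟩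
    2 ^ n + capital X (reverse X) k ≡⟨ +-comm (2 ^ n) _ ⟩
    capital X (reverse X) k + 2 ^ n ≡⟨ capital-ending X (reverse X) |X|≡n (endsWith-reverse X) ⟨
    capital X (reverse X) n ∎
    where open ≤-Reasoning

  pending-++ : ∀ V R → stateAfter (V ++ R) ≡ pending → stateAfter R ≡ pending
  pending-++ [] R e = e
  pending-++ (c ∷ V) R e = pending-++ V R (proj₁ (step≡pending (stateAfter (V ++ R)) (c ∷ V ++ R) e))

  wonA-++ : ∀ V R → stateAfter R ≡ wonA → stateAfter (V ++ R) ≡ wonA
  wonA-++ [] R e = e
  wonA-++ (c ∷ V) R e rewrite wonA-++ V R e = refl

  pending-short : ∀ R → length R < n → stateAfter R ≡ pending
  pending-short [] _ = refl
  pending-short (c ∷ R) |cR|<n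
    rewrite pending-short R (<-trans (n<1+n (length R)) |cR|<n)
          | endsWith-short A (c ∷ R) |A|≡n |cR|<n
          | endsWith-short B (c ∷ R) |B|≡n |cR|<n = refl

  stateAfter-reverseA : stateAfter (reverse A) ≡ wonA
  stateAfter-reverseA = from (reverse A) (trans (length-reverse A) |A|≡n) (endsWith-reverse A)
    where
    from : ∀ R → length R ≡ n → endsWith A R ≡ true → stateAfter R ≡ wonA
    from (c ∷ R) |cR|≡n p rewrite pending-short R (≤-reflexive |cR|≡n) | p = refl

  spellsA-once : sumWords n (λ V → 𝟙 (isPrefix (reverse A) V)) ≡ 1
  spellsA-once = subst (λ m → sumWords m (λ V → 𝟙 (isPrefix (reverse A) V)) ≡ 1)
    (trans (length-reverse A) |A|≡n) (sumWords-isPrefix (reverse A))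

  pending-killed-by-A : ∀ R V → length V ≡ n → 𝟙pending (V ++ R) + 𝟙pending R * 𝟙 (isPrefix (reverse A) V) ≤ 𝟙pending R
  pending-killed-by-A R V |V|≡n with stateAfter (V ++ R) in e
  ... | pending rewrite pending-++ V R e = ≤-reflexive (cong (λ b → 1 + 1 * 𝟙 b) ¬spellsA)
    where
    ¬spellsA : isPrefix (reverse A) V ≡ false
    ¬spellsA = trans (sym (isPrefix-extend (reverse A) V R (≤-reflexive (trans (length-reverse A) (trans |A|≡n (sym |V|≡n))))))
                     (proj₁ (pending⇒¬endsWith (V ++ R) e))
  ... | wonA = ≤-trans (*-monoʳ-≤ (𝟙pending R) (𝟙≤1 (isPrefix (reverse A) V))) (≤-reflexive (*-identityʳ _))
  ... | wonB = ≤-trans (*-monoʳ-≤ (𝟙pending R) (𝟙≤1 (isPrefix (reverse A) V))) (≤-reflexive (*-identityʳ _))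

  pendings-decay : ∀ N → pendings (n + N) + pendings N ≤ 2 ^ n * pendings N
  pendings-decay N = begin
    pendings (n + N) + pendings N
      ≡⟨ cong₂ _+_ (sumWords-++ n N 𝟙pending) (sumWords-cong N (λ R → sym (*-identityʳ (𝟙pending R)))) ⟩
    sumWords N (λ R → sumWords n (λ V → 𝟙pending (V ++ R))) + sumWords N (λ R → 𝟙pending R * 1)
      ≡⟨ sumWords-+ N ⟨
    sumWords N (λ R → sumWords n (λ V → 𝟙pending (V ++ R)) + 𝟙pending R * 1)
      ≡⟨ sumWords-cong N (λ R → cong (λ z → sumWords n (λ V → 𝟙pending (V ++ R)) + 𝟙pending R * z) (sym spellsA-once)) ⟩
    sumWords N (λ R → sumWords n (λ V → 𝟙pending (V ++ R)) + 𝟙pending R * sumWords n (λ V → 𝟙 (isPrefix (reverse A) V)))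
      ≡⟨ sumWords-cong N (λ R → cong (sumWords n (λ V → 𝟙pending (V ++ R)) +_) (sym (sumWords-* n (𝟙pending R) _))) ⟩
    sumWords N (λ R → sumWords n (λ V → 𝟙pending (V ++ R)) + sumWords n (λ V → 𝟙pending R * 𝟙 (isPrefix (reverse A) V)))
      ≡⟨ sumWords-cong N (λ R → sym (sumWords-+ n)) ⟩
    sumWords N (λ R → sumWords n (λ V → 𝟙pending (V ++ R) + 𝟙pending R * 𝟙 (isPrefix (reverse A) V)))
      ≤⟨ sumWords-mono N (λ R _ → sumWords-mono n (λ V |V|≡n → pending-killed-by-A R V |V|≡n)) ⟩
    sumWords N (λ R → sumWords n (λ V → 𝟙pending R))
      ≡⟨ sumWords-cong N (λ R → sumWords-const n (𝟙pending R)) ⟩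
    sumWords N (λ R → 2 ^ n * 𝟙pending R)
      ≡⟨ sumWords-* N (2 ^ n) 𝟙pending ⟩
    2 ^ n * pendings N ∎
    where open ≤-Reasoning

  winsA-lower : ∀ N → 2 ^ N ≤ winsA (N + n)
  winsA-lower N = begin
    2 ^ N                                                 ≡⟨ *-identityʳ _ ⟨
    2 ^ N * 1                                             ≡⟨ cong (2 ^ N *_) spellsA-once ⟨
    2 ^ N * sumWords n (λ V → 𝟙 (isPrefix (reverse A) V)) ≡⟨ sumWords-* n (2 ^ N) _ ⟨
    sumWords n (λ V → 2 ^ N * 𝟙 (isPrefix (reverse A) V)) ≤⟨ sumWords-mono n bound ⟩
    sumWords n (λ R → sumWords N (λ V → 𝟙 (isWonA (stateAfter (V ++ R))))) ≡⟨ sumWords-++ N n _ ⟨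
    winsA (N + n) ∎
    where
    open ≤-Reasoning
    bound : ∀ R → length R ≡ n → 2 ^ N * 𝟙 (isPrefix (reverse A) R) ≤ sumWords N (λ V → 𝟙 (isWonA (stateAfter (V ++ R))))
    bound R |R|≡n with isPrefix (reverse A) R in p
    ... | false = ≤-trans (≤-reflexive (*-zeroʳ (2 ^ N))) z≤n
    ... | true = ≤-reflexive (begin-equality
      2 ^ N * 1                 ≡⟨ sumWords-const N 1 ⟨
      sumWords N (λ _ → 1)      ≡⟨ sumWords-cong N (λ V → cong (𝟙 ∘ isWonA) (sym (wonA-++ V R R-wonA))) ⟩
      sumWords N (λ V → 𝟙 (isWonA (stateAfter (V ++ R)))) ∎)
      where
      R-wonA : stateAfter R ≡ wonA
      R-wonA = trans (cong stateAfter (sym (isPrefix⇒≡ (reverse A) R p (trans (length-reverse A) (trans |A|≡n (sym |R|≡n))))))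
                     stateAfter-reverseA

  pendings-suc : ∀ N → pendings (suc N) ≤ 2 * pendings N
  pendings-suc N = begin
    pendings (suc N)                               ≡⟨ sumWords-∷ N 𝟙pending ⟩
    sumWords N (λ R → 𝟙pending (H ∷ R) + 𝟙pending (T ∷ R)) ≤⟨ sumWords-mono N (λ R _ → +-mono-≤ (stays H R) (≤-trans (stays T R) (m≤m+n _ 0))) ⟩
    sumWords N (λ R → 2 * 𝟙pending R)              ≡⟨ sumWords-* N 2 𝟙pending ⟩
    2 * pendings N ∎
    where
    open ≤-Reasoning
    stays : ∀ c R → 𝟙pending (c ∷ R) ≤ 𝟙pending R
    stays c R with stateAfter (c ∷ R) in e
    ... | pending rewrite pending-++ (c ∷ []) R e = ≤-refl
    ... | wonA = z≤n
    ... | wonB = z≤n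

  pendings-+ : ∀ d N → pendings (d + N) ≤ 2 ^ d * pendings N
  pendings-+ zero N = ≤-reflexive (sym (+-identityʳ _))
  pendings-+ (suc d) N = begin
    pendings (suc d + N)       ≤⟨ pendings-suc (d + N) ⟩
    2 * pendings (d + N)       ≤⟨ *-monoʳ-≤ 2 (pendings-+ d N) ⟩
    2 * (2 ^ d * pendings N)   ≡⟨ *-assoc 2 (2 ^ d) _ ⟨
    2 ^ suc d * pendings N ∎
    where open ≤-Reasoning

  pendings-* : ∀ a → 2 ^ n ≡ suc a → ∀ m → pendings (m * n) ≤ a ^ m
  pendings-* a 2^n≡1+a zero = ≤-refl
  pendings-* a 2^n≡1+a (suc m) = +-cancelʳ-≤ (pendings (m * n)) _ _ (begin
    pendings (n + m * n) + pendings (m * n)  ≤⟨ pendings-decay (m * n) ⟩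
    2 ^ n * pendings (m * n)                 ≡⟨ cong (_* pendings (m * n)) 2^n≡1+a ⟩
    pendings (m * n) + a * pendings (m * n)  ≤⟨ +-monoʳ-≤ (pendings (m * n)) (*-monoʳ-≤ a (pendings-* a 2^n≡1+a m)) ⟩
    pendings (m * n) + a * a ^ m             ≡⟨ +-comm (pendings (m * n)) (a * a ^ m) ⟩
    a ^ suc m + pendings (m * n) ∎)
    where open ≤-Reasoning

  pendings-negligible : ∀ C → ∃ λ N₀ → ∀ M → N₀ ≤ M → C * pendings M < 2 ^ M
  pendings-negligible C with 2^≡suc n
  ... | a , 2^n≡1+a = N₀ , eventually
    where
    m N₀ : ℕ
    m = suc (C * a)
    N₀ = m * n
    at-N₀ : C * pendings N₀ < 2 ^ N₀
    at-N₀ = begin-strict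
      C * pendings N₀ ≤⟨ *-monoʳ-≤ C (pendings-* a 2^n≡1+a m) ⟩
      C * a ^ m       <⟨ *^<suc^ C a ⟩
      suc a ^ m       ≡⟨ cong (_^ m) 2^n≡1+a ⟨
      (2 ^ n) ^ m     ≡⟨ ^-*-assoc 2 n m ⟩
      2 ^ (n * m)     ≡⟨ cong (2 ^_) (*-comm n m) ⟩
      2 ^ N₀ ∎
      where open ≤-Reasoning
    eventually : ∀ M → N₀ ≤ M → C * pendings M < 2 ^ M
    eventually M N₀≤M with m≤n⇒∃[o]m+o≡n N₀≤M
    ... | d , refl = begin-strict
      C * pendings (N₀ + d)      ≡⟨ cong (λ z → C * pendings z) (+-comm N₀ d) ⟩
      C * pendings (d + N₀)      ≤⟨ *-monoʳ-≤ C (pendings-+ d N₀) ⟩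
      C * (2 ^ d * pendings N₀)  ≡⟨ x∙yz≈y∙xz C (2 ^ d) (pendings N₀) ⟩
      2 ^ d * (C * pendings N₀)  <⟨ *-monoʳ-< (2 ^ d) {{m^n≢0 2 d}} at-N₀ ⟩
      2 ^ d * 2 ^ N₀             ≡⟨ ^-distribˡ-+-* 2 d N₀ ⟨
      2 ^ (d + N₀)               ≡⟨ cong (2 ^_) (+-comm d N₀) ⟩
      2 ^ (N₀ + d) ∎
      where open ≤-Reasoning

-- From counts to q

length-filter-𝟙 : ∀ (f : List Coin → Bool) ws → length (filter (λ w → f w Bool.≟ true) ws) ≡ sumOver (𝟙 ∘ f) ws
length-filter-𝟙 f [] = refl
length-filter-𝟙 f (w ∷ ws) with f w
... | true = cong suc (length-filter-𝟙 f ws)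
... | false = length-filter-𝟙 f ws

toList-injective : ∀ {m} (xs ys : Vec Coin m) → toList xs ≡ toList ys → xs ≡ ys
toList-injective xs ys eq = trans (sym (Vec.cast-is-id refl xs)) (Vec.toList-injective refl xs ys eq)

private
  scaled-< : ∀ b x y S c K → 1 ≤ b → b * x ≤ b * y + S → c * S < K → x * c < y * c + K
  scaled-< b x y S c K 1≤b bx≤by+S cS<K = *-cancelˡ-< b (x * c) (y * c + K) (begin-strict
    b * (x * c)           ≡⟨ *-assoc b x c ⟨
    b * x * c             ≤⟨ *-monoˡ-≤ c bx≤by+S ⟩
    (b * y + S) * c       ≡⟨ expand b y S c ⟩
    b * (y * c) + c * S   <⟨ +-monoʳ-< (b * (y * c)) cS<K ⟩
    b * (y * c) + K       ≤⟨ +-monoʳ-≤ (b * (y * c)) (≤-trans (≤-reflexive (sym (*-identityˡ K))) (*-monoˡ-≤ K 1≤b)) ⟩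
    b * (y * c) + b * K   ≡⟨ *-distribˡ-+ b (y * c) K ⟨
    b * (y * c + K) ∎)
    where
    open ≤-Reasoning
    expand : ∀ b y S c → (b * y + S) * c ≡ b * (y * c) + c * S
    expand = solve-∀

module Criteria {k : ℕ} (Av Bv : Vec Coin (suc k)) (A≢B : Av ≢ Bv) where
  open import Data.Integer using (-_; ∣_∣; _⊖_)

  A B : List Coin
  A = toList Av
  B = toList Bv

  |A|≡n : length A ≡ suc k
  |A|≡n = Vec.length-toList Av

  |B|≡n : length B ≡ suc k
  |B|≡n = Vec.length-toList Bv

  A≢B′ : A ≢ B
  A≢B′ = A≢B ∘ toList-injective Av Bv

  open RaceBetween A B |A|≡n |B|≡n A≢B′

  count≡winsA : ∀ M → count Av Bv M ≡ winsA M
  count≡winsA M = trans (length-filter-𝟙 (beats A B) (allWords M))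
    (trans (sumWords-reverse M _) (sumWords-cong M (λ R → cong 𝟙 (beatsA≡isWonA R))))

  count≡winsB : ∀ M → count Bv Av M ≡ winsB M
  count≡winsB M = trans (length-filter-𝟙 (beats B A) (allWords M))
    (trans (sumWords-reverse M _) (sumWords-cong M (λ R → cong 𝟙 (beatsB≡isWonB R))))

  diff-* : ∀ M c → diff Av Bv M ℤ.* ℤ.+ c ≡ (winsB M * c) ⊖ (winsA M * c)
  diff-* M c rewrite count≡winsA M | count≡winsB M = +-*-⊖ (winsB M) (winsA M) c

  AA AB BA BB : ℕ
  AA = capital A (reverse A) n
  AB = capital A (reverse B) n
  BA = capital B (reverse A) n
  BB = capital B (reverse B) n

  a b : ℕ
  a = AA ∸ BA
  b = BB ∸ AB

  AA≡BA+a : AA ≡ BA + a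
  AA≡BA+a = sym (m+[n∸m]≡n (<⇒≤ (capital-self>other A B |A|≡n |B|≡n A≢B′)))

  BB≡AB+b : BB ≡ AB + b
  BB≡AB+b = sym (m+[n∸m]≡n (<⇒≤ (capital-self>other B A |B|≡n |A|≡n (A≢B′ ∘ sym))))

  1≤b : 1 ≤ b
  1≤b = +-cancelˡ-≤ AB 1 b (begin
    AB + 1 ≡⟨ +-comm AB 1 ⟩
    suc AB ≤⟨ capital-self>other B A |B|≡n |A|≡n (A≢B′ ∘ sym) ⟩
    BB     ≡⟨ BB≡AB+b ⟩
    AB + b ∎)
    where open ≤-Reasoning

  AA+AB≡ : AA + AB ≡ BA + AB + a
  AA+AB≡ = trans (cong (_+ AB) AA≡BA+a) (rearrange BA a AB)
    where
    rearrange : ∀ x y z → x + y + z ≡ x + z + y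
    rearrange = solve-∀

  BA+BB≡ : BA + BB ≡ BA + AB + b
  BA+BB≡ = trans (cong (BA +_) BB≡AB+b) (sym (+-assoc BA AB b))

  conway-odds : ∀ N → a * winsA N + pendingCapital A N ≡ b * winsB N + pendingCapital B N
  conway-odds N = +-cancelˡ-≡ (BA * x + AB * y) _ _ (begin
    BA * x + AB * y + (a * x + pendingCapital A N) ≡⟨ collect₁ BA AB a x y (pendingCapital A N) ⟩
    (BA + a) * x + AB * y + pendingCapital A N     ≡⟨ cong (λ z → z * x + AB * y + pendingCapital A N) AA≡BA+a ⟨
    AA * x + AB * y + pendingCapital A N           ≡⟨ conway-identity N ⟩
    BA * x + BB * y + pendingCapital B N           ≡⟨ cong (λ z → BA * x + z * y + pendingCapital B N) BB≡AB+b ⟩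
    BA * x + (AB + b) * y + pendingCapital B N     ≡⟨ collect₂ BA AB b x y (pendingCapital B N) ⟨
    BA * x + AB * y + (b * y + pendingCapital B N) ∎)
    where
    open ≡-Reasoning
    x y : ℕ
    x = winsA N
    y = winsB N
    collect₁ : ∀ β γ a x y u → β * x + γ * y + (a * x + u) ≡ (β + a) * x + γ * y + u
    collect₁ = solve-∀
    collect₂ : ∀ β γ b x y u → β * x + γ * y + (b * y + u) ≡ β * x + (γ + b) * y + u
    collect₂ = solve-∀

  D : ℕ
  D = 2 ^ suc n

  winsA-bound : ∀ c → c ≤ a → ∀ M → c * winsA M ≤ b * winsB M + D * pendings M
  winsA-bound c c≤a M = begin
    c * winsA M                       ≤⟨ *-monoˡ-≤ (winsA M) c≤a ⟩
    a * winsA M                       ≤⟨ m≤m+n (a * winsA M) (pendingCapital A M) ⟩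
    a * winsA M + pendingCapital A M  ≡⟨ conway-odds M ⟩
    b * winsB M + pendingCapital B M  ≤⟨ +-monoʳ-≤ (b * winsB M) (pendingCapital≤ B M) ⟩
    b * winsB M + D * pendings M ∎
    where open ≤-Reasoning

  winsB-bound : ∀ c → a ≤ c → ∀ M → b * winsB M ≤ c * winsA M + D * pendings M
  winsB-bound c a≤c M = begin
    b * winsB M                       ≤⟨ m≤m+n (b * winsB M) (pendingCapital B M) ⟩
    b * winsB M + pendingCapital B M  ≡⟨ conway-odds M ⟨
    a * winsA M + pendingCapital A M  ≤⟨ +-mono-≤ (*-monoˡ-≤ (winsA M) a≤c) (pendingCapital≤ A M) ⟩
    c * winsA M + D * pendings M ∎
    where open ≤-Reasoning

  D*winsA-lower : ∀ M → n ≤ M → 2 * 2 ^ M ≤ D * winsA M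
  D*winsA-lower M n≤M with m≤n⇒∃[o]m+o≡n n≤M
  ... | N , refl = begin
    2 * 2 ^ (n + N)    ≡⟨ ^-distribˡ-+-* 2 (suc n) N ⟩
    D * 2 ^ N          ≤⟨ *-monoʳ-≤ D (winsA-lower N) ⟩
    D * winsA (N + n)  ≡⟨ cong (λ z → D * winsA z) (+-comm N n) ⟩
    D * winsA (n + N) ∎
    where open ≤-Reasoning

  D*pendings-negligible : ∀ C → ∃ λ N₀ → ∀ M → N₀ ≤ M → C * (D * pendings M) < 2 ^ M
  D*pendings-negligible C with pendings-negligible (C * D)
  ... | N₀ , negligible = N₀ , λ M N₀≤M → subst (_< 2 ^ M) (*-assoc C D (pendings M)) (negligible M N₀≤M)

  q≥1-criterion : BA + BB ≤ AA + AB → q≥1 Av Bv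
  q≥1-criterion sums≤ k′ with D*pendings-negligible (suc k′)
  ... | N₀ , negligible = N₀ , above
    where
    b≤a : b ≤ a
    b≤a = +-cancelˡ-≤ (BA + AB) b a (subst₂ _≤_ BA+BB≡ AA+AB≡ sums≤)
    above : ∀ M → N₀ ≤ M → - (ℤ.+ (2 ^ M)) ℤ.< diff Av Bv M ℤ.* ℤ.+ suc k′
    above M N₀≤M = subst (- (ℤ.+ (2 ^ M)) ℤ.<_) (sym (diff-* M (suc k′)))
      (-K<⊖ (winsB M * suc k′) (winsA M * suc k′) (2 ^ M) {{m^n≢0 2 M}}
        (scaled-< b (winsA M) (winsB M) (D * pendings M) (suc k′) (2 ^ M) 1≤b (winsA-bound b b≤a M) (negligible M N₀≤M)))

  q≡1-criterion : AA + AB ≡ BA + BB → q≡1 Av Bv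
  q≡1-criterion sums≡ k′ with D*pendings-negligible (suc k′)
  ... | N₀ , negligible = N₀ , near
    where
    a≡b : a ≡ b
    a≡b = +-cancelˡ-≡ (BA + AB) a b (trans (sym AA+AB≡) (trans sums≡ BA+BB≡))
    near : ∀ M → N₀ ≤ M → ∣ diff Av Bv M ℤ.* ℤ.+ suc k′ ∣ < 2 ^ M
    near M N₀≤M = subst (λ w → ∣ w ∣ < 2 ^ M) (sym (diff-* M (suc k′)))
      (∣⊖∣< (winsB M * suc k′) (winsA M * suc k′) (2 ^ M)
        (scaled-< b (winsB M) (winsA M) (D * pendings M) (suc k′) (2 ^ M) 1≤b (winsB-bound b (≤-reflexive a≡b) M) (negligible M N₀≤M))
        (scaled-< b (winsA M) (winsB M) (D * pendings M) (suc k′) (2 ^ M) 1≤b (winsA-bound b (≤-reflexive (sym a≡b)) M) (negligible M N₀≤M)))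

  instance
    b≢0 : NonZero b
    b≢0 = >-nonZero 1≤b
    D≢0 : NonZero D
    D≢0 = m^n≢0 2 (suc n)

  c : ℕ
  c = b * D

  1+[c-1]≡c : suc (pred c) ≡ c
  1+[c-1]≡c = suc-pred c {{m*n≢0 b D}}

  c-scaling : ∀ z → z * c ≡ D * (b * z)
  c-scaling z = reorder z b D
    where
    reorder : ∀ z b D → z * (b * D) ≡ D * (b * z)
    reorder = solve-∀

  q≢1-criterion : BA + BB < AA + AB → ¬ q≡1 Av Bv
  q≢1-criterion sums< close with close (pred c) | D*pendings-negligible D
  ... | N₁ , near | N₂ , negligible = <-irrefl refl (begin-strict
    2 * 2 ^ M + D * (b * x)          ≤⟨ room ⟩
    D * (b * y) + D * (D * s)        <⟨ +-mono-< y-near small ⟩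
    D * (b * x) + 2 ^ M + 2 ^ M      ≡⟨ rearrange (D * (b * x)) (2 ^ M) ⟩
    2 * 2 ^ M + D * (b * x) ∎)
    where
    open ≤-Reasoning
    M x y s : ℕ
    M = N₁ + N₂ + n
    x = winsA M
    y = winsB M
    s = pendings M
    rearrange : ∀ u K → u + K + K ≡ 2 * K + u
    rearrange = solve-∀
    b<a : suc b ≤ a
    b<a = +-cancelˡ-≤ (BA + AB) (suc b) a (≤-trans (≤-reflexive (+-suc (BA + AB) b)) (subst₂ _<_ BA+BB≡ AA+AB≡ sums<))
    room : 2 * 2 ^ M + D * (b * x) ≤ D * (b * y) + D * (D * s)
    room = begin
      2 * 2 ^ M + D * (b * x)   ≤⟨ +-monoˡ-≤ (D * (b * x)) (D*winsA-lower M (m≤n+m n _)) ⟩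
      D * x + D * (b * x)       ≡⟨ *-distribˡ-+ D x (b * x) ⟨
      D * (suc b * x)           ≤⟨ *-monoʳ-≤ D (winsA-bound (suc b) b<a M) ⟩
      D * (b * y + D * s)       ≡⟨ *-distribˡ-+ D (b * y) (D * s) ⟩
      D * (b * y) + D * (D * s) ∎
    y-near : D * (b * y) < D * (b * x) + 2 ^ M
    y-near = subst₂ (λ u v → u < v + 2 ^ M) (c-scaling y) (c-scaling x)
      (∣⊖∣<⇒< (y * c) (x * c) (2 ^ M) (subst (λ w → ∣ w ∣ < 2 ^ M) (diff-* M c)
        (subst (λ z → ∣ diff Av Bv M ℤ.* ℤ.+ z ∣ < 2 ^ M) 1+[c-1]≡c (near M (≤-trans (m≤m+n N₁ N₂) (m≤m+n _ n))))))
    small : D * (D * s) < 2 ^ M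
    small = negligible M (≤-trans (m≤n+m N₂ N₁) (m≤m+n _ n))

  q<1-criterion : AA + AB < BA + BB → q<1 Av Bv
  q<1-criterion sums< with D*pendings-negligible D
  ... | N₀ , negligible = pred c , N₀ + n , λ M N₀+n≤M →
    subst (λ z → diff Av Bv M ℤ.* ℤ.+ z ℤ.< - (ℤ.+ (2 ^ M))) (sym 1+[c-1]≡c) (far M N₀+n≤M)
    where
    a<b : suc a ≤ b
    a<b = +-cancelˡ-≤ (BA + AB) (suc a) b (≤-trans (≤-reflexive (+-suc (BA + AB) a)) (subst₂ _<_ AA+AB≡ BA+BB≡ sums<))
    far : ∀ M → N₀ + n ≤ M → diff Av Bv M ℤ.* ℤ.+ c ℤ.< - (ℤ.+ (2 ^ M))
    far M N₀+n≤M = subst (ℤ._< - (ℤ.+ (2 ^ M))) (sym (diff-* M c))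
      (⊖<- (y * c) (x * c) (2 ^ M) (subst₂ (λ u v → u + 2 ^ M < v) (sym (c-scaling y)) (sym (c-scaling x)) gap))
      where
      x y s : ℕ
      x = winsA M
      y = winsB M
      s = pendings M
      rearrange₁ : ∀ a x e → a * x + e + x ≡ x + a * x + e
      rearrange₁ = solve-∀
      rearrange₂ : ∀ u K → u + K + K ≡ u + 2 * K
      rearrange₂ = solve-∀
      bound : b * y + x ≤ b * x + D * s
      bound = begin
        b * y + x           ≤⟨ +-monoˡ-≤ x (winsB-bound a ≤-refl M) ⟩
        a * x + D * s + x   ≡⟨ rearrange₁ a x (D * s) ⟩
        suc a * x + D * s   ≤⟨ +-monoˡ-≤ (D * s) (*-monoˡ-≤ x a<b) ⟩
        b * x + D * s ∎
        where open ≤-Reasoning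
      gap : D * (b * y) + 2 ^ M < D * (b * x)
      gap = +-cancelʳ-< (2 ^ M) _ _ (begin-strict
        D * (b * y) + 2 ^ M + 2 ^ M    ≡⟨ rearrange₂ (D * (b * y)) (2 ^ M) ⟩
        D * (b * y) + 2 * 2 ^ M        ≤⟨ +-monoʳ-≤ (D * (b * y)) (D*winsA-lower M (≤-trans (m≤n+m n N₀) N₀+n≤M)) ⟩
        D * (b * y) + D * x            ≡⟨ *-distribˡ-+ D (b * y) x ⟨
        D * (b * y + x)                ≤⟨ *-monoʳ-≤ D bound ⟩
        D * (b * x + D * s)            ≡⟨ *-distribˡ-+ D (b * x) (D * s) ⟩
        D * (b * x) + D * (D * s)      <⟨ +-monoʳ-< (D * (b * x)) (negligible M (≤-trans (m≤m+n N₀ n) N₀+n≤M)) ⟩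
        D * (b * x) + 2 ^ M ∎)
        where open ≤-Reasoning

-- Against a constant string

matchCount : List Coin → List Coin → List Coin → ℕ → ℕ
matchCount X R S j = 𝟙 (matches X (suc j) R) + 𝟙 (matches X (suc j) S)

capital-pair-suc : ∀ X R S j →
  capital X R (suc j) + capital X S (suc j) ≡ (capital X R j + capital X S j) + matchCount X R S j * 2 ^ suc j
capital-pair-suc X R S j =
  collect (capital X R j) (capital X S j) (𝟙 (matches X (suc j) R)) (𝟙 (matches X (suc j) S)) (2 ^ suc j)
  where
  collect : ∀ p q u v e → p + u * e + (q + v * e) ≡ p + q + (u + v) * e
  collect = solve-∀

module _ (X Y R S : List Coin) where

  capital-pair-mono : ∀ k → (∀ j → j < k → matchCount Y R S j ≤ matchCount X R S j) →
                      capital Y R k + capital Y S k ≤ capital X R k + capital X S k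
  capital-pair-mono zero _ = ≤-refl
  capital-pair-mono (suc k) ≤X = subst₂ _≤_ (sym (capital-pair-suc Y R S k)) (sym (capital-pair-suc X R S k))
    (+-mono-≤ (capital-pair-mono k (λ j j<k → ≤X j (m<n⇒m<1+n j<k))) (*-monoˡ-≤ (2 ^ suc k) (≤X k ≤-refl)))

  capital-pair-strict : ∀ k → (∀ j → j < k → matchCount Y R S j ≤ matchCount X R S j) →
                        ∀ i → i < k → matchCount Y R S i < matchCount X R S i →
                        capital Y R k + capital Y S k < capital X R k + capital X S k
  capital-pair-strict (suc k) ≤X i i<1+k <X with m≤n⇒m<n∨m≡n (s≤s⁻¹ i<1+k)
  ... | inj₁ i<k = subst₂ _<_ (sym (capital-pair-suc Y R S k)) (sym (capital-pair-suc X R S k))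
    (+-mono-<-≤ (capital-pair-strict k (λ j j<k → ≤X j (m<n⇒m<1+n j<k)) i i<k <X) (*-monoˡ-≤ (2 ^ suc k) (≤X k ≤-refl)))
  ... | inj₂ refl = subst₂ _<_ (sym (capital-pair-suc Y R S i)) (sym (capital-pair-suc X R S i))
    (+-mono-≤-< (capital-pair-mono i (λ j j<i → ≤X j (m<n⇒m<1+n j<i))) (*-monoˡ-< (2 ^ suc i) {{m^n≢0 2 (suc i)}} <X))

  capital-pair-cong : ∀ k → (∀ j → j < k → matchCount Y R S j ≡ matchCount X R S j) →
                      capital Y R k + capital Y S k ≡ capital X R k + capital X S k
  capital-pair-cong zero _ = refl
  capital-pair-cong (suc k) ≡X = begin
    capital Y R (suc k) + capital Y S (suc k)                        ≡⟨ capital-pair-suc Y R S k ⟩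
    capital Y R k + capital Y S k + matchCount Y R S k * 2 ^ suc k   ≡⟨ cong₂ (λ u v → u + v * 2 ^ suc k)
                                                                         (capital-pair-cong k (λ j j<k → ≡X j (m<n⇒m<1+n j<k)))
                                                                         (≡X k ≤-refl) ⟩
    capital X R k + capital X S k + matchCount X R S k * 2 ^ suc k   ≡⟨ capital-pair-suc X R S k ⟨
    capital X R (suc k) + capital X S (suc k) ∎
    where open ≡-Reasoning

opposite : Coin → Coin
opposite H = T
opposite T = H

==-opposite : ∀ c → (c == opposite c) ≡ false
==-opposite H = refl
==-opposite T = refl

opposite-== : ∀ c → (opposite c == c) ≡ false
opposite-== H = refl
opposite-== T = refl

coin-cases : ∀ c d → d ≡ c ⊎ d ≡ opposite c
coin-cases H H = inj₁ refl
coin-cases H T = inj₂ refl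
coin-cases T H = inj₂ refl
coin-cases T T = inj₁ refl

replicate-∷ʳ : ∀ k (c : Coin) → replicate k c ∷ʳ c ≡ replicate (suc k) c
replicate-∷ʳ zero c = refl
replicate-∷ʳ (suc k) c = cong (c ∷_) (replicate-∷ʳ k c)

letter-replicate-++ : ∀ k c L i → i < k → letter (replicate k c ++ L) i ≡ c
letter-replicate-++ (suc k) c L zero _ = refl
letter-replicate-++ (suc k) c L (suc i) (s≤s i<k) = letter-replicate-++ k c L i i<k

revPrefix-replicate-++ : ∀ k c L j → j ≤ k → revPrefix (replicate k c ++ L) j ≡ replicate j c
revPrefix-replicate-++ k c L zero _ = refl
revPrefix-replicate-++ k c L (suc j) j<k =
  cong₂ _∷_ (letter-replicate-++ k c L j j<k) (revPrefix-replicate-++ k c L j (<⇒≤ j<k))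

revPrefix-replicate : ∀ k c j → j ≤ k → revPrefix (replicate k c) j ≡ replicate j c
revPrefix-replicate k c j j≤k =
  subst (λ Z → revPrefix Z j ≡ replicate j c) (++-identityʳ (replicate k c)) (revPrefix-replicate-++ k c [] j j≤k)

reverse-replicate : ∀ k (c : Coin) → reverse (replicate k c) ≡ replicate k c
reverse-replicate k c = begin
  reverse (replicate k c)                         ≡⟨ revPrefix-length (replicate k c) ⟨
  revPrefix (replicate k c) (length (replicate k c)) ≡⟨ cong (revPrefix (replicate k c)) (length-replicate k) ⟩
  revPrefix (replicate k c) k                     ≡⟨ revPrefix-replicate k c k ≤-refl ⟩
  replicate k c ∎
  where open ≡-Reasoning

isPrefix-replicate : ∀ j k c → j ≤ k → isPrefix (replicate j c) (replicate k c) ≡ true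
isPrefix-replicate zero k c _ = refl
isPrefix-replicate (suc j) (suc k) c (s≤s j≤k) rewrite ==-refl c = isPrefix-replicate j k c j≤k

isPrefix-replicate⇒ : ∀ Z k c → isPrefix Z (replicate k c) ≡ true → Z ≡ replicate (length Z) c
isPrefix-replicate⇒ [] k c _ = refl
isPrefix-replicate⇒ (z ∷ Z) (suc k) c p =
  cong₂ _∷_ (==⇒≡ z c (∧-trueˡ p)) (isPrefix-replicate⇒ Z k c (∧-trueʳ {z == c} p))

isPrefix-mismatch : ∀ x d Z u → (x == d) ≡ false → isPrefix (x ∷ Z) (d ∷ u) ≡ false
isPrefix-mismatch x d Z u x≠d rewrite x≠d = refl

revPrefix-shift⇒constant : ∀ B j → isPrefix (revPrefix B j) (revPrefix B (suc j)) ≡ true → ∀ i → i ≤ j → letter B i ≡ letter B 0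
revPrefix-shift⇒constant B j p zero _ = refl
revPrefix-shift⇒constant B (suc j) p (suc i) (s≤s i≤j) with m≤n⇒m<n∨m≡n i≤j
... | inj₁ i<j = revPrefix-shift⇒constant B j (∧-trueʳ {letter B j == letter B (suc j)} p) (suc i) i<j
... | inj₂ refl = trans (sym (==⇒≡ (letter B i) (letter B (suc i)) (∧-trueˡ p)))
                        (revPrefix-shift⇒constant B i (∧-trueʳ {letter B i == letter B (suc i)} p) i ≤-refl)

revPrefix≡replicate⇒letter : ∀ B j c → revPrefix B j ≡ replicate j c → ∀ i → i < j → letter B i ≡ c
revPrefix≡replicate⇒letter B (suc j) c e i (s≤s i≤j) with m≤n⇒m<n∨m≡n i≤j
... | inj₁ i<j = revPrefix≡replicate⇒letter B j c (∷-injectiveʳ e) i i<j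
... | inj₂ refl = ∷-injectiveˡ e

letters⇒replicate : ∀ L d → (∀ i → i < length L → letter L i ≡ d) → L ≡ replicate (length L) d
letters⇒replicate [] d _ = refl
letters⇒replicate (x ∷ L) d ≡d = cong₂ _∷_ (≡d 0 z<s) (letters⇒replicate L d (λ i i<|L| → ≡d (suc i) (s<s i<|L|)))

letters⇒replicate-∷ʳ : ∀ L k c → length L ≡ suc k → (∀ i → i < k → letter L i ≡ c) → L ≡ replicate k c ∷ʳ letter L k
letters⇒replicate-∷ʳ (x ∷ []) zero c _ _ = refl
letters⇒replicate-∷ʳ (x ∷ L) (suc k) c |L|≡ ≡c =
  cong₂ _∷_ (≡c 0 z<s) (letters⇒replicate-∷ʳ L k c (suc-injective |L|≡) (λ i i<k → ≡c (suc i) (s<s i<k)))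

module ConstantRival (c : Coin) (m : ℕ) where

  n : ℕ
  n = suc (suc m)

  A : List Coin
  A = replicate n c

  c′ : Coin
  c′ = opposite c

  allOpposite nearlyConstant : List Coin
  allOpposite = replicate n c′
  nearlyConstant = replicate (suc m) c ∷ʳ c′

  A-matches-itself : ∀ j → j < n → matches A (suc j) (reverse A) ≡ true
  A-matches-itself j j<n =
    trans (cong₂ isPrefix (revPrefix-replicate n c (suc j) j<n) (reverse-replicate n c)) (isPrefix-replicate (suc j) n c j<n)

  module _ (B : List Coin) (|B|≡n : length B ≡ n) (B≢A : B ≢ A) where

    same-start : ∀ j → j < n → matches B (suc j) (reverse A) ≡ true → revPrefix B (suc j) ≡ revPrefix A (suc j)
    same-start j j<n p = begin
      revPrefix B (suc j)
        ≡⟨ isPrefix-replicate⇒ (revPrefix B (suc j)) n c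
             (subst (λ R → isPrefix (revPrefix B (suc j)) R ≡ true) (reverse-replicate n c) p) ⟩
      replicate (length (revPrefix B (suc j))) c ≡⟨ cong (λ l → replicate l c) (length-revPrefix B (suc j)) ⟩
      replicate (suc j) c                       ≡⟨ revPrefix-replicate n c (suc j) j<n ⟨
      revPrefix A (suc j) ∎
      where open ≡-Reasoning

    matchCount-≤ : ∀ j → j < n → matchCount B (reverse A) (reverse B) j ≤ matchCount A (reverse A) (reverse B) j
    matchCount-≤ j j<n rewrite A-matches-itself j j<n with matches B (suc j) (reverse A) in p
    ... | true = ≤-reflexive (cong (λ Z → 1 + 𝟙 (isPrefix Z (reverse B))) (same-start j j<n p))
    ... | false = ≤-trans (𝟙≤1 (matches B (suc j) (reverse B))) (s≤s z≤n)

    sums-≤ : capital B (reverse A) n + capital B (reverse B) n ≤ capital A (reverse A) n + capital A (reverse B) n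
    sums-≤ = capital-pair-mono A B (reverse A) (reverse B) n matchCount-≤

    m<n : m < n
    m<n = s≤s (n≤1+n m)

    starts-like-A⇒ : matches B (suc m) (reverse A) ≡ true → B ≡ replicate (suc m) c ∷ʳ letter B (suc m)
    starts-like-A⇒ p = letters⇒replicate-∷ʳ B (suc m) c |B|≡n
      (revPrefix≡replicate⇒letter B (suc m) c (trans (same-start m m<n p) (revPrefix-replicate n c (suc m) m<n)))

    starts-like-A⇒nearlyConstant : matches B (suc m) (reverse A) ≡ true → B ≡ nearlyConstant
    starts-like-A⇒nearlyConstant p with coin-cases c (letter B (suc m))
    ... | inj₁ e = ⊥-elim (B≢A (trans (starts-like-A⇒ p) (trans (cong (replicate (suc m) c ∷ʳ_) e) (replicate-∷ʳ (suc m) c))))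
    ... | inj₂ e = trans (starts-like-A⇒ p) (cong (replicate (suc m) c ∷ʳ_) e)

    self-overlapping⇒ : matches B (suc m) (reverse B) ≡ true → B ≡ replicate n (letter B 0)
    self-overlapping⇒ q = trans
      (letters⇒replicate B (letter B 0) (λ i i<|B| →
        revPrefix-shift⇒constant B (suc m) (subst (λ R → isPrefix (revPrefix B (suc m)) R ≡ true) rB≡ q) i
          (s≤s⁻¹ (subst (i <_) |B|≡n i<|B|))))
      (cong (λ l → replicate l (letter B 0)) |B|≡n)
      where
      rB≡ : reverse B ≡ revPrefix B n
      rB≡ = sym (trans (cong (revPrefix B) (sym |B|≡n)) (revPrefix-length B))

    self-overlapping⇒allOpposite : matches B (suc m) (reverse B) ≡ true → B ≡ allOpposite
    self-overlapping⇒allOpposite q with coin-cases c (letter B 0)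
    ... | inj₁ e = ⊥-elim (B≢A (trans (self-overlapping⇒ q) (cong (replicate n) e)))
    ... | inj₂ e = trans (self-overlapping⇒ q) (cong (replicate n) e)

    BelowA : Set
    BelowA = capital B (reverse A) n + capital B (reverse B) n < capital A (reverse A) n + capital A (reverse B) n

    neither⇒BelowA : matches B (suc m) (reverse A) ≡ false → matches B (suc m) (reverse B) ≡ false → BelowA
    neither⇒BelowA p q = capital-pair-strict A B (reverse A) (reverse B) n matchCount-≤ m m<n gap
      where
      gap : matchCount B (reverse A) (reverse B) m < matchCount A (reverse A) (reverse B) m
      gap rewrite p | q | A-matches-itself m m<n = s≤s z≤n

    classify : B ≡ allOpposite ⊎ B ≡ nearlyConstant ⊎ BelowA
    classify = by-start _ refl
      where
      by-overlap : matches B (suc m) (reverse A) ≡ false → ∀ b → matches B (suc m) (reverse B) ≡ b →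
                   B ≡ allOpposite ⊎ B ≡ nearlyConstant ⊎ BelowA
      by-overlap p true q = inj₁ (self-overlapping⇒allOpposite q)
      by-overlap p false q = inj₂ (inj₂ (neither⇒BelowA p q))
      by-start : ∀ b → matches B (suc m) (reverse A) ≡ b → B ≡ allOpposite ⊎ B ≡ nearlyConstant ⊎ BelowA
      by-start true p = inj₂ (inj₁ (starts-like-A⇒nearlyConstant p))
      by-start false p = by-overlap p _ refl

  private
    exactly-one : ∀ {J I} → (J ≡ true × I ≡ false) ⊎ (J ≡ false × I ≡ true) → 𝟙 J + 𝟙 I ≡ 1
    exactly-one (inj₁ (refl , refl)) = refl
    exactly-one (inj₂ (refl , refl)) = refl

  A-matchCount : ∀ B j → j < n → matches A (suc j) (reverse B) ≡ false → matchCount A (reverse A) (reverse B) j ≡ 1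
  A-matchCount B j j<n unlike = exactly-one (inj₁ (A-matches-itself j j<n , unlike))

  sums-≡-allOpposite : capital allOpposite (reverse A) n + capital allOpposite (reverse allOpposite) n ≡
                       capital A (reverse A) n + capital A (reverse allOpposite) n
  sums-≡-allOpposite = capital-pair-cong A allOpposite (reverse A) (reverse allOpposite) n
    (λ j j<n → trans (exactly-one (inj₂ (unlikeA j j<n , likeSelf j j<n))) (sym (A-matchCount allOpposite j j<n (A-unlike j j<n))))
    where
    unlikeA : ∀ j → j < n → matches allOpposite (suc j) (reverse A) ≡ false
    unlikeA j j<n = trans (cong₂ isPrefix (revPrefix-replicate n c′ (suc j) j<n) (reverse-replicate n c))
                    (isPrefix-mismatch c′ c (replicate j c′) (replicate (suc m) c) (opposite-== c))
    likeSelf : ∀ j → j < n → matches allOpposite (suc j) (reverse allOpposite) ≡ true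
    likeSelf j j<n = trans (cong₂ isPrefix (revPrefix-replicate n c′ (suc j) j<n) (reverse-replicate n c′)) (isPrefix-replicate (suc j) n c′ j<n)
    A-unlike : ∀ j → j < n → matches A (suc j) (reverse allOpposite) ≡ false
    A-unlike j j<n = trans (cong₂ isPrefix (revPrefix-replicate n c (suc j) j<n) (reverse-replicate n c′))
                    (isPrefix-mismatch c c′ (replicate j c) (replicate (suc m) c′) (==-opposite c))

  reverse-nearlyConstant : reverse nearlyConstant ≡ c′ ∷ replicate (suc m) c
  reverse-nearlyConstant = trans (reverse-++ (replicate (suc m) c) (c′ ∷ [])) (cong (c′ ∷_) (reverse-replicate (suc m) c))

  sums-≡-nearlyConstant : capital nearlyConstant (reverse A) n + capital nearlyConstant (reverse nearlyConstant) n ≡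
                          capital A (reverse A) n + capital A (reverse nearlyConstant) n
  sums-≡-nearlyConstant = capital-pair-cong A nearlyConstant (reverse A) (reverse nearlyConstant) n
    (λ j j<n → trans (exactly-one (one-of j j<n)) (sym (A-matchCount nearlyConstant j j<n (A-unlike j j<n))))
    where
    A-unlike : ∀ j → j < n → matches A (suc j) (reverse nearlyConstant) ≡ false
    A-unlike j j<n = trans (cong₂ isPrefix (revPrefix-replicate n c (suc j) j<n) reverse-nearlyConstant)
                    (isPrefix-mismatch c c′ (replicate j c) (replicate (suc m) c) (==-opposite c))
    one-of : ∀ j → j < n → (matches nearlyConstant (suc j) (reverse A) ≡ true × matches nearlyConstant (suc j) (reverse nearlyConstant) ≡ false)
                         ⊎ (matches nearlyConstant (suc j) (reverse A) ≡ false × matches nearlyConstant (suc j) (reverse nearlyConstant) ≡ true)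
    one-of j j<n with m≤n⇒m<n∨m≡n (s≤s⁻¹ j<n)
    ... | inj₁ j<1+m = inj₁
      ( trans (cong₂ isPrefix prefix (reverse-replicate n c)) (isPrefix-replicate (suc j) n c j<n)
      , trans (cong₂ isPrefix prefix reverse-nearlyConstant) (isPrefix-mismatch c c′ (replicate j c) (replicate (suc m) c) (==-opposite c)) )
      where
      prefix : revPrefix nearlyConstant (suc j) ≡ replicate (suc j) c
      prefix = revPrefix-replicate-++ (suc m) c (c′ ∷ []) (suc j) j<1+m
    ... | inj₂ refl = inj₂
      ( trans (cong₂ isPrefix whole (reverse-replicate n c)) (isPrefix-mismatch c′ c (replicate (suc m) c) (replicate (suc m) c) (opposite-== c))
      , trans (cong (λ Z → isPrefix Z (reverse nearlyConstant)) (trans whole (sym reverse-nearlyConstant))) (isPrefix-refl (reverse nearlyConstant)) )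
      where
      whole : revPrefix nearlyConstant n ≡ c′ ∷ replicate (suc m) c
      whole = begin
        revPrefix nearlyConstant n
          ≡⟨ cong (revPrefix nearlyConstant) (trans (length-∷ʳ (replicate (suc m) c) c′) (cong suc (length-replicate (suc m)))) ⟨
        revPrefix nearlyConstant (length nearlyConstant)    ≡⟨ revPrefix-length nearlyConstant ⟩
        reverse nearlyConstant                              ≡⟨ reverse-nearlyConstant ⟩
        c′ ∷ replicate (suc m) c ∎
        where open ≡-Reasoning

module ConstantCase (c : Coin) (m : ℕ) where
  open ConstantRival c m public

  C : Vec Coin n
  C = Vec.replicate n c

  toList-C : toList C ≡ A
  toList-C = Vec.toList-replicate n c

  Compare : (ℕ → ℕ → Set) → List Coin → List Coin → Set
  Compare _∼_ Y Z = (capital Y (reverse Z) n + capital Y (reverse Y) n) ∼ (capital Z (reverse Z) n + capital Z (reverse Y) n)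

  module Against (Bv : Vec Coin n) (Bv≢C : Bv ≢ C) where
    open Criteria C Bv (Bv≢C ∘ sym) using (q≥1-criterion; q≡1-criterion; q≢1-criterion)

    Bl : List Coin
    Bl = toList Bv

    Bl≢A : Bl ≢ A
    Bl≢A e = Bv≢C (toList-injective Bv C (trans e (sym toList-C)))

    at-C : ∀ _∼_ → Compare _∼_ Bl A → Compare _∼_ Bl (toList C)
    at-C _∼_ = subst (Compare _∼_ Bl) (sym toList-C)

    q≥1-against : q≥1 C Bv
    q≥1-against = q≥1-criterion (at-C _≤_ (sums-≤ Bl (Vec.length-toList Bv) Bl≢A))

    module _ (S₁ S₂ : Vec Coin n) (toList-S₁ : toList S₁ ≡ allOpposite) (toList-S₂ : toList S₂ ≡ nearlyConstant) where

      q≡1⇒special : q≡1 C Bv → Bv ≡ S₁ ⊎ Bv ≡ S₂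
      q≡1⇒special q≡1 with classify Bl (Vec.length-toList Bv) Bl≢A
      ... | inj₁ e = inj₁ (toList-injective Bv S₁ (trans e (sym toList-S₁)))
      ... | inj₂ (inj₁ e) = inj₂ (toList-injective Bv S₂ (trans e (sym toList-S₂)))
      ... | inj₂ (inj₂ below) = ⊥-elim (q≢1-criterion (at-C _<_ below) q≡1)

      special⇒q≡1 : Bv ≡ S₁ ⊎ Bv ≡ S₂ → q≡1 C Bv
      special⇒q≡1 special = q≡1-criterion (sym (at-C _≡_ (balanced special)))
        where
        balanced : Bv ≡ S₁ ⊎ Bv ≡ S₂ → Compare _≡_ Bl A
        balanced (inj₁ refl) = subst (λ Y → Compare _≡_ Y A) (sym toList-S₁) sums-≡-allOpposite
        balanced (inj₂ refl) = subst (λ Y → Compare _≡_ Y A) (sym toList-S₂) sums-≡-nearlyConstant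

  beaten-by-C : (Av : Vec Coin n) → Av ≢ C → Compare _<_ (toList Av) A → q<1 Av C
  beaten-by-C Av Av≢C below = q<1-criterion (subst (λ Z → Compare _>_ Z Al) (sym toList-C)
    (subst₂ _<_ (+-comm (capital Al (reverse A) n) _) (+-comm (capital A (reverse A) n) _) below))
    where
    open Criteria Av C Av≢C using (q<1-criterion)
    Al : List Coin
    Al = toList Av

  constant-case : (S₁ S₂ : Vec Coin n) → toList S₁ ≡ allOpposite → toList S₂ ≡ nearlyConstant →
    ∀ Bv → ¬ (Bv ≡ C) → q≥1 C Bv × (q≡1 C Bv → Bv ≡ S₁ ⊎ Bv ≡ S₂) × (Bv ≡ S₁ ⊎ Bv ≡ S₂ → q≡1 C Bv)
  constant-case S₁ S₂ toList-S₁ toList-S₂ Bv Bv≢C =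
    q≥1-against , q≡1⇒special S₁ S₂ toList-S₁ toList-S₂ , special⇒q≡1 S₁ S₂ toList-S₁ toList-S₂
    where open Against Bv Bv≢C

toList-hsT : ∀ k → toList (hsT (suc k)) ≡ replicate k H ∷ʳ T
toList-hsT zero = refl
toList-hsT (suc k) = cong (H ∷_) (toList-hsT k)

toList-tsH : ∀ k → toList (tsH (suc k)) ≡ replicate k T ∷ʳ H
toList-tsH zero = refl
toList-tsH (suc k) = cong (T ∷_) (toList-tsH k)

toList≢replicate : ∀ {n} (Av : Vec Coin n) c → Av ≢ Vec.replicate n c → toList Av ≢ replicate n c
toList≢replicate Av c Av≢cⁿ e = Av≢cⁿ (toList-injective Av _ (trans e (sym (Vec.toList-replicate _ c))))

nonconstant-case : ∀ m (Av : Vec Coin (suc (suc m))) → ¬ (Av ≡ allH _) → ¬ (Av ≡ allT _) →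
  ∃ λ (Bv : Vec Coin (suc (suc m))) → ¬ (Bv ≡ Av) × q<1 Av Bv
nonconstant-case m Av ≢Hⁿ ≢Tⁿ with ConstantRival.classify H m (toList Av) (Vec.length-toList Av) (toList≢replicate Av H ≢Hⁿ)
... | inj₁ e = ⊥-elim (toList≢replicate Av T ≢Tⁿ e)
... | inj₂ (inj₂ below) = allH _ , ≢Hⁿ ∘ sym , ConstantCase.beaten-by-C H m Av ≢Hⁿ below
... | inj₂ (inj₁ e) with ConstantRival.classify T m (toList Av) (Vec.length-toList Av) (toList≢replicate Av T ≢Tⁿ)
...   | inj₁ e′ = ⊥-elim (toList≢replicate Av H ≢Hⁿ e′)
...   | inj₂ (inj₁ e′) with () ← ∷-injectiveˡ (trans (sym e) e′)
...   | inj₂ (inj₂ below) = allT _ , ≢Tⁿ ∘ sym , ConstantCase.beaten-by-C T m Av ≢Tⁿ below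

lemma6p1 : ∀ (n : ℕ) → 3 ≤ n →
    ((∀ (B : Vec Coin n) → ¬ (B ≡ allH n) →
        q≥1 (allH n) B
        × (q≡1 (allH n) B → (B ≡ allT n ⊎ B ≡ hsT n))
        × ((B ≡ allT n ⊎ B ≡ hsT n) → q≡1 (allH n) B))
    × (∀ (B : Vec Coin n) → ¬ (B ≡ allT n) →
        q≥1 (allT n) B
        × (q≡1 (allT n) B → (B ≡ allH n ⊎ B ≡ tsH n))
        × ((B ≡ allH n ⊎ B ≡ tsH n) → q≡1 (allT n) B))
    × (∀ (A : Vec Coin n) → ¬ (A ≡ allH n) → ¬ (A ≡ allT n) →
        ∃ λ (B : Vec Coin n) → ¬ (B ≡ A) × q<1 A B))
lemma6p1 (suc (suc m)) _ =
  ConstantCase.constant-case H m (allT _) (hsT _) (Vec.toList-replicate _ T) (toList-hsT (suc m)) ,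
  ConstantCase.constant-case T m (allH _) (tsH _) (Vec.toList-replicate _ H) (toList-tsH (suc m)) ,
  nonconstant-case m
lemma6p1 (suc zero) (s≤s ())
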